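{- Let $w$ be a power of two. There is a branch-free straight-line program (no tests and no branches) on a word RAM with $w$-bit words, consisting of $O(\log w)$ word operations, which on input a $w$-bit word $x$ representing the string $\mathbf s=s_0\cdots s_{w-1}$ (bit $i$ of $x$ is $s_i$) with $s_0=1$, outputs the position of the closed parenthesis matching the open parenthesis at position $0$, namely the least $j$ with $0<j<w$ and $E_{\mathbf s}(j+1)=0$, if such a $j$ exists, and a fixed special value (different from all positions $0,\dots,w-1$) otherwise.
   Context: Bit strings are viewed as parentheses: $1$ = open, $0$ = closed. The closed excess function of $\mathbf s$ is $E_{\mathbf s}(i)=|\{j<i : s_j=0\}|-|\{j<i: s_j=1\}|$. The word RAM model: words are $w$-bit unsigned integers (two's-complement interpretation where needed); in unit time it performs bitwise and, or, xor, complement, left and right shifts (including arithmetic right shift with sign extension) by constant or computed amounts, additions and subtractions modulo $2^w$, and comparisons are not used; a constant number of multiplications modulo $2^w$ are also allowed (each of which could be replaced by $O(\log w)$ shifts and additions). A straight-line program is a fixed sequence of such assignments from the input and constants, with no conditional branching. -}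

module Defs where

open import Data.Nat using (ℕ; zero; suc; _+_; _*_; _∸_; _^_; _≤_; _<_; _≡ᵇ_)
open import Data.Nat.DivMod using (_/_; _%_)
open import Data.Bool using (Bool; true; false; if_then_else_; _∧_; _∨_; _xor_; not)
open import Data.Fin using (Fin)
open import Data.Vec using (Vec; lookup; []; _∷_)
open import Data.Integer as ℤ using (ℤ)
open import Data.Product using (Σ; _×_)
open import Data.Sum using (_⊎_)
open import Relation.Binary.PropositionalEquality using (_≡_; _≢_)
open import Data.Nat using (NonZero)
open import Data.Nat.Properties using (m^n≢0)

divPow : ℕ → ℕ → ℕ
divPow x i = _/_ x (2 ^ i) {{m^n≢0 2 i}}

modPow : ℕ → ℕ → ℕ
modPow x i = _%_ x (2 ^ i) {{m^n≢0 2 i}}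

-- w-bit words are natural numbers in [0, 2^w); bit i of x is (x / 2^i) mod 2.

bit : ℕ → ℕ → ℕ
bit x i = divPow x i % 2

wrap : ℕ → ℕ → ℕ
wrap w x = modPow x w

odd? : ℕ → Bool
odd? n = (n % 2) ≡ᵇ 1

fromBool : Bool → ℕ
fromBool true  = 1
fromBool false = 0

bitwise : (Bool → Bool → Bool) → ℕ → ℕ → ℕ → ℕ
bitwise f zero    x y = 0
bitwise f (suc w) x y = fromBool (f (odd? x) (odd? y)) + 2 * bitwise f w (x / 2) (y / 2)

-- word operations (arguments assumed to be w-bit words)
andW orW xorW addW subW mulW shlW shrW sarW : ℕ → ℕ → ℕ → ℕ
andW w = bitwise _∧_ w
orW  w = bitwise _∨_ w
xorW w = bitwise _xor_ w
addW w x y = wrap w (x + y)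
subW w x y = wrap w (x + (2 ^ w ∸ y))
mulW w x y = wrap w (x * y)
-- left shift by a (amounts ≥ w give 0)
shlW w x a = wrap w (x * 2 ^ a)
shrW w x a = divPow x a
-- arithmetic right shift by a: sign bit (bit w-1) is replicated into the top a bits
sarW w x a = if odd? (bit x (w ∸ 1))
             then divPow x a + (2 ^ w ∸ 2 ^ (w ∸ a))
             else divPow x a

notW : ℕ → ℕ → ℕ
notW w x = (2 ^ w ∸ 1) ∸ x

-- A program with n values available (the input
-- and the results of earlier assignments) is a sequence of assignments,
-- each operating on earlier values or on constants, ending with an output.

data Operand (n : ℕ) : Set where
  reg : Fin n → Operand n      -- an earlier value (de Bruijn: 0 = most recent)
  imm : ℕ → Operand n          -- a constant (reduced mod 2^w)

data Op₂ : Set where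
  AND OR XOR SHL SHR SAR ADD SUB MUL : Op₂

data Instr (n : ℕ) : Set where
  un  : Operand n → Instr n
  bin : Op₂ → Operand n → Operand n → Instr n

data SLP (n : ℕ) : Set where
  ret : Operand n → SLP n
  _▹_ : Instr n → SLP (suc n) → SLP n

infixr 5 _▹_

size : ∀ {n} → SLP n → ℕ
size (ret _) = 0
size (_ ▹ p) = suc (size p)

isMul : ∀ {n} → Instr n → ℕ
isMul (bin MUL _ _) = 1
isMul _             = 0

mulCount : ∀ {n} → SLP n → ℕ
mulCount (ret _) = 0
mulCount (i ▹ p) = isMul i + mulCount p

evalOperand : ∀ {n} → ℕ → Vec ℕ n → Operand n → ℕ
evalOperand w ρ (reg r) = lookup ρ r
evalOperand w ρ (imm c) = wrap w c

evalOp₂ : Op₂ → ℕ → ℕ → ℕ → ℕ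
evalOp₂ AND = andW
evalOp₂ OR  = orW
evalOp₂ XOR = xorW
evalOp₂ SHL = shlW
evalOp₂ SHR = shrW
evalOp₂ SAR = sarW
evalOp₂ ADD = addW
evalOp₂ SUB = subW
evalOp₂ MUL = mulW

evalInstr : ∀ {n} → ℕ → Vec ℕ n → Instr n → ℕ
evalInstr w ρ (un a)        = notW w (evalOperand w ρ a)
evalInstr w ρ (bin o a b)   = evalOp₂ o w (evalOperand w ρ a) (evalOperand w ρ b)

evalSLP : ∀ {n} → ℕ → Vec ℕ n → SLP n → ℕ
evalSLP w ρ (ret a) = evalOperand w ρ a
evalSLP w ρ (i ▹ p) = evalSLP w (evalInstr w ρ i ∷ ρ) p

run : ℕ → SLP 1 → ℕ → ℕ
run w p x = evalSLP w (x ∷ []) p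

-- Parentheses: bit 1 = open, bit 0 = closed.
-- Closed excess E_s(i) = #{j < i : s_j = 0} - #{j < i : s_j = 1}.

excess : ℕ → ℕ → ℤ
excess x zero    = ℤ.0ℤ
excess x (suc i) = excess x i ℤ.+ (if odd? (bit x i) then ℤ.-1ℤ else ℤ.1ℤ)

IsMatch : ℕ → ℕ → ℕ → Set
IsMatch w x j = (0 < j) × (j < w) × (excess x (suc j) ≡ ℤ.0ℤ)
              × (∀ j′ → 0 < j′ → j′ < j → excess x (suc j′) ≢ ℤ.0ℤ)

NoMatch : ℕ → ℕ → Set
NoMatch w x = ∀ j → 0 < j → j < w → excess x (suc j) ≢ ℤ.0ℤ

CorrectOutput : ℕ → ℕ → ℕ → ℕ → Set
CorrectOutput w special x out =
  (Σ ℕ λ j → IsMatch w x j × out ≡ j) ⊎ (NoMatch w x × out ≡ special)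

module Submission where

-- For w = 2^k let z i = 1 ∸ s_(i+1) mark the closed symbols after position 0.
-- A block of z has two statistics: cl, its number of closed symbols, and md,
-- the largest closed excess of one of its prefixes.  The combination lemma
-- 'md-combine' computes md of two adjacent blocks from md and cl of the left
-- one and md of the right one, with +, ∸ and ⊔ only.
--
-- The branch-free program has three phases.  Bottom-up, 21 SWAR instructions
-- per level compute words C ℓ and D ℓ holding cl and md of all aligned blocks
-- of length 2^ℓ in packed fields (the maximum uses a guard bit).  Top-down, a
-- state (h, p) with h + 2·cl(0,p) = 1 + p descends from the whole word to one
-- symbol: the match lies in the left half of the current block iff h ≤ md of
-- that half, tested with an arithmetic shift.  A leaf step outputs p + 1 or w.

open import Defs
open import Data.Nat
open import Data.Nat.Properties
open import Data.Nat.DivMod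
open import Data.Nat.Divisibility using (divides)
open import Data.Nat.Tactic.RingSolver using (solve-∀)
open import Data.Bool using (true; false; _∧_; if_then_else_)
open import Data.Bool.Properties using (∧-comm; ∧-identityʳ)
open import Data.Product using (Σ; _×_; _,_; proj₁; proj₂)
open import Data.Sum using (_⊎_; inj₁; inj₂)
open import Data.Empty using (⊥-elim)
open import Data.List using (List; []; _∷_; _++_; length; drop)
import Data.List.Properties as List
open import Data.Vec using (Vec; toList)
import Data.Vec as Vec
open import Data.Fin using (zero; suc)
import Data.Integer as ℤ
import Data.Integer.Properties as ℤP
import Data.Integer.Tactic.RingSolver as ℤSolver
open import Relation.Nullary using (yes; no)
open import Relation.Nullary.Decidable using (from-yes)
open import Relation.Binary.PropositionalEquality

[r+q*n]/n≡q : ∀ r q n .{{_ : NonZero n}} → r < n → (r + q * n) / n ≡ q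
[r+q*n]/n≡q r q n r<n = begin
    (r + q * n) / n   ≡⟨ +-distrib-/-∣ʳ r (divides q refl) ⟩
    r / n + q * n / n ≡⟨ cong₂ _+_ (m<n⇒m/n≡0 r<n) (m*n/n≡m q n) ⟩
    q                 ∎
  where open ≡-Reasoning

[r+q*n]%n≡r : ∀ r q n .{{_ : NonZero n}} → r < n → (r + q * n) % n ≡ r
[r+q*n]%n≡r r q n r<n = trans ([m+kn]%n≡m%n r q n) (m<n⇒m%n≡m r<n)

[a+2t]/2 : ∀ a t → (a + 2 * t) / 2 ≡ a / 2 + t
[a+2t]/2 a t = begin
    (a + 2 * t) / 2   ≡⟨ cong (λ u → (a + u) / 2) (*-comm 2 t) ⟩
    (a + t * 2) / 2   ≡⟨ +-distrib-/-∣ʳ a (divides t refl) ⟩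
    a / 2 + t * 2 / 2 ≡⟨ cong (a / 2 +_) (m*n/n≡m t 2) ⟩
    a / 2 + t         ∎
  where open ≡-Reasoning

odd?[a+2t] : ∀ a t → odd? (a + 2 * t) ≡ odd? a
odd?[a+2t] a t =
  cong (_≡ᵇ 1) (trans (cong (λ u → (a + u) % 2) (*-comm 2 t)) ([m+kn]%n≡m%n a t 2))

fromBool-odd? : ∀ a → fromBool (odd? a) ≡ a % 2
fromBool-odd? a with a % 2 | m%n<n a 2
... | 0           | _ = refl
... | 1           | _ = refl
... | suc (suc _) | s≤s (s≤s ())

x≡x%2+2[x/2] : ∀ x → x ≡ x % 2 + 2 * (x / 2)
x≡x%2+2[x/2] x = trans (m≡m%n+[m/n]*n x 2) (cong (x % 2 +_) (*-comm (x / 2) 2))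

half-< : ∀ a m → a < 2 ^ suc m → a / 2 < 2 ^ m
half-< a m a< = m<n*o⇒m/o<n (subst (a <_) (*-comm 2 (2 ^ m)) a<)

-- Every n fits into n bits; this bounds shift amounts and field contents.
n<2^n : ∀ n → n < 2 ^ n
n<2^n zero    = s≤s z≤n
n<2^n (suc n) = begin-strict
    suc n         <⟨ s≤s (n<2^n n) ⟩
    suc (2 ^ n)   ≡⟨ +-comm 1 (2 ^ n) ⟩
    2 ^ n + 1     ≤⟨ +-monoʳ-≤ (2 ^ n) (m^n>0 2 n) ⟩
    2 ^ n + 2 ^ n ≡⟨ cong (2 ^ n +_) (sym (+-identityʳ (2 ^ n))) ⟩
    2 * 2 ^ n     ∎
  where open ≤-Reasoning

bitwise-split : ∀ f m n a b c d → a < 2 ^ m → c < 2 ^ m →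
  bitwise f (m + n) (a + 2 ^ m * b) (c + 2 ^ m * d)
    ≡ bitwise f m a c + 2 ^ m * bitwise f n b d
bitwise-split f zero n zero b zero d _ _
  rewrite *-identityˡ b | *-identityˡ d | *-identityˡ (bitwise f n b d) = refl
bitwise-split f zero n (suc a) b c d (s≤s ()) _
bitwise-split f zero n zero b (suc c) d _ (s≤s ())
bitwise-split f (suc m) n a b c d a< c< = begin
    fromBool (f (odd? A) (odd? C)) + 2 * bitwise f (m + n) (A / 2) (C / 2)
      ≡⟨ cong₂ (λ u v → fromBool (f u v) + 2 * bitwise f (m + n) (A / 2) (C / 2))
               (low-bit a b) (low-bit c d) ⟩
    bit0 + 2 * bitwise f (m + n) (A / 2) (C / 2)
      ≡⟨ cong₂ (λ u v → bit0 + 2 * bitwise f (m + n) u v) (halve a b) (halve c d) ⟩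
    bit0 + 2 * bitwise f (m + n) (a / 2 + 2 ^ m * b) (c / 2 + 2 ^ m * d)
      ≡⟨ cong (λ u → bit0 + 2 * u)
              (bitwise-split f m n (a / 2) b (c / 2) d (half-< a m a<) (half-< c m c<)) ⟩
    bit0 + 2 * (bitwise f m (a / 2) (c / 2) + 2 ^ m * rest)
      ≡⟨ regroup bit0 (bitwise f m (a / 2) (c / 2)) (2 ^ m) rest ⟩
    bit0 + 2 * bitwise f m (a / 2) (c / 2) + 2 * 2 ^ m * rest
      ∎
  where
  open ≡-Reasoning
  A : ℕ
  A = a + 2 ^ suc m * b
  C : ℕ
  C = c + 2 ^ suc m * d
  bit0 : ℕ
  bit0 = fromBool (f (odd? a) (odd? c))
  rest : ℕ
  rest = bitwise f n b d
  regroup : ∀ p q s r → p + 2 * (q + s * r) ≡ p + 2 * q + 2 * s * r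
  regroup = solve-∀
  low-bit : ∀ u v → odd? (u + 2 ^ suc m * v) ≡ odd? u
  low-bit u v = trans (cong (λ t → odd? (u + t)) (*-assoc 2 (2 ^ m) v)) (odd?[a+2t] u (2 ^ m * v))
  halve : ∀ u v → (u + 2 ^ suc m * v) / 2 ≡ u / 2 + 2 ^ m * v
  halve u v = trans (cong (λ t → (u + t) / 2) (*-assoc 2 (2 ^ m) v)) ([a+2t]/2 u (2 ^ m * v))

ones : ℕ → ℕ
ones zero    = 0
ones (suc n) = 1 + 2 * ones n

ones<2^n : ∀ n → ones n < 2 ^ n
ones<2^n zero    = s≤s z≤n
ones<2^n (suc n) = ≤-trans (≤-reflexive (sym (*-suc 2 (ones n)))) (*-monoʳ-≤ 2 (ones<2^n n))

ones+1≡2^n : ∀ n → ones n + 1 ≡ 2 ^ n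
ones+1≡2^n zero    = refl
ones+1≡2^n (suc n) = begin
    suc (2 * ones n) + 1 ≡⟨ cong suc (+-comm (2 * ones n) 1) ⟩
    2 + 2 * ones n       ≡⟨ sym (*-suc 2 (ones n)) ⟩
    2 * suc (ones n)     ≡⟨ cong (2 *_) (trans (+-comm 1 (ones n)) (ones+1≡2^n n)) ⟩
    2 * 2 ^ n            ∎
  where open ≡-Reasoning

ones≡2^n∸1 : ∀ n → ones n ≡ 2 ^ n ∸ 1
ones≡2^n∸1 n = sym (trans (cong (_∸ 1) (sym (ones+1≡2^n n))) (m+n∸n≡m (ones n) 1))

and-comm : ∀ n x y → andW n x y ≡ andW n y x
and-comm zero    x y = refl
and-comm (suc n) x y =
  cong₂ (λ a b → fromBool a + 2 * b) (∧-comm (odd? x) (odd? y)) (and-comm n (x / 2) (y / 2))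

and-zeroʳ : ∀ n x → andW n x 0 ≡ 0
and-zeroʳ zero    x = refl
and-zeroʳ (suc n) x rewrite and-zeroʳ n (x / 2) with odd? x
... | true  = refl
... | false = refl

and-zeroˡ : ∀ n x → andW n 0 x ≡ 0
and-zeroˡ n x = trans (and-comm n 0 x) (and-zeroʳ n x)

and-onesʳ : ∀ n x → x < 2 ^ n → andW n x (ones n) ≡ x
and-onesʳ zero    zero    _ = refl
and-onesʳ zero    (suc x) (s≤s ())
and-onesʳ (suc n) x x< = begin
    fromBool (odd? x ∧ odd? (1 + 2 * ones n)) + 2 * andW n (x / 2) ((1 + 2 * ones n) / 2)
      ≡⟨ cong₂ (λ u v → fromBool (odd? x ∧ u) + 2 * andW n (x / 2) v)
               (odd?[a+2t] 1 (ones n)) ([a+2t]/2 1 (ones n)) ⟩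
    fromBool (odd? x ∧ true) + 2 * andW n (x / 2) (ones n)
      ≡⟨ cong₂ (λ u v → fromBool u + 2 * v) (∧-identityʳ (odd? x)) (and-onesʳ n (x / 2) (half-< x n x<)) ⟩
    fromBool (odd? x) + 2 * (x / 2)
      ≡⟨ cong (_+ 2 * (x / 2)) (fromBool-odd? x) ⟩
    x % 2 + 2 * (x / 2)
      ≡⟨ sym (x≡x%2+2[x/2] x) ⟩
    x ∎
  where open ≡-Reasoning

and-onesˡ : ∀ n x → x < 2 ^ n → andW n (ones n) x ≡ x
and-onesˡ n x h = trans (and-comm n (ones n) x) (and-onesʳ n x h)

-- Padding with a zero high part, to apply 'bitwise-split'.
x≡x+2^g*0 : ∀ x g → x ≡ x + 2 ^ g * 0
x≡x+2^g*0 x g = sym (trans (cong (x +_) (*-zeroʳ (2 ^ g))) (+-identityʳ x))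

and-ones-wide : ∀ g n x → x < 2 ^ g → andW (g + n) x (ones g) ≡ x
and-ones-wide g n x x< = begin
    andW (g + n) x (ones g)
      ≡⟨ cong₂ (andW (g + n)) (x≡x+2^g*0 x g) (x≡x+2^g*0 (ones g) g) ⟩
    andW (g + n) (x + 2 ^ g * 0) (ones g + 2 ^ g * 0)
      ≡⟨ bitwise-split _∧_ g n x 0 (ones g) 0 x< (ones<2^n g) ⟩
    andW g x (ones g) + 2 ^ g * andW n 0 0
      ≡⟨ cong₂ (λ a b → a + 2 ^ g * b) (and-onesʳ g x x<) (and-zeroʳ n 0) ⟩
    x + 2 ^ g * 0
      ≡⟨ sym (x≡x+2^g*0 x g) ⟩
    x ∎
  where open ≡-Reasoning

field-low : ∀ B B' a b → a < 2 ^ B → andW (B + B') (a + 2 ^ B * b) (ones B + 2 ^ B * 0) ≡ a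
field-low B B' a b a< = begin
    andW (B + B') (a + 2 ^ B * b) (ones B + 2 ^ B * 0)
      ≡⟨ bitwise-split _∧_ B B' a b (ones B) 0 a< (ones<2^n B) ⟩
    andW B a (ones B) + 2 ^ B * andW B' b 0
      ≡⟨ cong₂ (λ p q → p + 2 ^ B * q) (and-onesʳ B a a<) (and-zeroʳ B' b) ⟩
    a + 2 ^ B * 0
      ≡⟨ sym (x≡x+2^g*0 a B) ⟩
    a ∎
  where open ≡-Reasoning

field-high : ∀ B B' a b → a < 2 ^ B → b < 2 ^ B' →
  andW (B + B') (a + 2 ^ B * b) (0 + 2 ^ B * ones B') ≡ 2 ^ B * b
field-high B B' a b a< b< = begin
    andW (B + B') (a + 2 ^ B * b) (0 + 2 ^ B * ones B')
      ≡⟨ bitwise-split _∧_ B B' a b 0 (ones B') a< (m^n>0 2 B) ⟩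
    andW B a 0 + 2 ^ B * andW B' b (ones B')
      ≡⟨ cong₂ (λ p q → p + 2 ^ B * q) (and-zeroʳ B a) (and-onesʳ B' b b<) ⟩
    2 ^ B * b ∎
  where open ≡-Reasoning

wrap-id : ∀ w x → x < 2 ^ w → wrap w x ≡ x
wrap-id w x h = m<n⇒m%n≡m {{m^n≢0 2 w}} h

wrap-0 : ∀ w → wrap w 0 ≡ 0
wrap-0 w = wrap-id w 0 (m^n>0 2 w)

wrap-< : ∀ w x → wrap w x < 2 ^ w
wrap-< w x = m%n<n x (2 ^ w) {{m^n≢0 2 w}}

add-id : ∀ w a b → a + b < 2 ^ w → addW w a b ≡ a + b
add-id w a b h = wrap-id w (a + b) h

add-0 : ∀ w a → a < 2 ^ w → addW w a 0 ≡ a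
add-0 w a a< = trans (cong (wrap w) (+-identityʳ a)) (wrap-id w a a<)

sub-id : ∀ w a b → b ≤ a → a < 2 ^ w → subW w a b ≡ a ∸ b
sub-id w a b b≤a a< = begin
    modPow (a + (2 ^ w ∸ b)) w ≡⟨ cong (λ z → modPow z w) borrow ⟩
    modPow ((a ∸ b) + 1 * 2 ^ w) w
      ≡⟨ [r+q*n]%n≡r (a ∸ b) 1 (2 ^ w) {{m^n≢0 2 w}} (≤-<-trans (m∸n≤m a b) a<) ⟩
    a ∸ b ∎
  where
  open ≡-Reasoning
  borrow : a + (2 ^ w ∸ b) ≡ (a ∸ b) + 1 * 2 ^ w
  borrow = begin
    a + (2 ^ w ∸ b)   ≡⟨ sym (+-∸-assoc a (≤-trans b≤a (<⇒≤ a<))) ⟩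
    a + 2 ^ w ∸ b     ≡⟨ +-∸-comm (2 ^ w) b≤a ⟩
    a ∸ b + 2 ^ w     ≡⟨ cong (a ∸ b +_) (sym (+-identityʳ (2 ^ w))) ⟩
    (a ∸ b) + 1 * 2 ^ w ∎

t+2^g∸s<2^g : ∀ g s t → t < s → t + 2 ^ g ∸ s < 2 ^ g
t+2^g∸s<2^g g s t t<s = begin-strict
    t + 2 ^ g ∸ s     ≤⟨ ∸-monoʳ-≤ (t + 2 ^ g) t<s ⟩
    t + 2 ^ g ∸ suc t ≡⟨ [t+G]∸[1+t] t ⟩
    2 ^ g ∸ 1         <⟨ ∸-monoʳ-< {2 ^ g} {1} {0} (s≤s z≤n) (m^n>0 2 g) ⟩
    2 ^ g             ∎
  where
  open ≤-Reasoning
  [t+G]∸[1+t] : ∀ t → t + 2 ^ g ∸ suc t ≡ 2 ^ g ∸ 1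
  [t+G]∸[1+t] zero    = refl
  [t+G]∸[1+t] (suc t) = [t+G]∸[1+t] t

sub-borrow : ∀ w d h → d < h → h ≤ 2 ^ w → subW w d h ≡ d + (2 ^ w ∸ h)
sub-borrow w d h d<h h≤ = wrap-id w _ (begin-strict
    d + (2 ^ w ∸ h) ≡⟨ sym (+-∸-assoc d h≤) ⟩
    d + 2 ^ w ∸ h   <⟨ t+2^g∸s<2^g w h d d<h ⟩
    2 ^ w           ∎)
  where open ≤-Reasoning

not-ones : ∀ w → notW w (ones w) ≡ 0
not-ones w = trans (cong (_∸ ones w) (sym (ones≡2^n∸1 w))) (n∸n≡0 (ones w))

not-zero : ∀ w → notW w 0 ≡ ones w
not-zero w = sym (ones≡2^n∸1 w)

-- An arithmetic shift by v of a (v+1)-bit word yields all zeros or all ones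
-- according to its top bit: this turns a borrow into a branch-free mask.
sar-top-clear : ∀ v t → t < 2 ^ v → sarW (suc v) t v ≡ 0
sar-top-clear v t t< with divPow t v | m<n⇒m/n≡0 {t} {2 ^ v} {{m^n≢0 2 v}} t<
... | .0 | refl = refl

sar-top-set : ∀ v t → 2 ^ v ≤ t → t < 2 ^ suc v → sarW (suc v) t v ≡ ones (suc v)
sar-top-set v t le t< with divPow t v | top-bit
  where
  top-bit : divPow t v ≡ 1
  top-bit = trans (cong (λ q → _/_ q (2 ^ v) {{m^n≢0 2 v}}) (sym split))
                  ([r+q*n]/n≡q (t ∸ 2 ^ v) 1 (2 ^ v) {{m^n≢0 2 v}} low<)
    where
    split : (t ∸ 2 ^ v) + 1 * 2 ^ v ≡ t
    split = trans (cong ((t ∸ 2 ^ v) +_) (+-identityʳ (2 ^ v))) (m∸n+n≡m le)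
    low< : t ∸ 2 ^ v < 2 ^ v
    low< = +-cancelʳ-< (2 ^ v) (t ∸ 2 ^ v) (2 ^ v)
             (subst (_< 2 ^ v + 2 ^ v) (sym (m∸n+n≡m le))
                    (subst (t <_) (cong (2 ^ v +_) (+-identityʳ (2 ^ v))) t<))
... | .1 | refl = begin
    1 + (2 ^ suc v ∸ 2 ^ (suc v ∸ v)) ≡⟨ cong (λ q → 1 + (2 ^ suc v ∸ 2 ^ q)) (m+n∸n≡m 1 v) ⟩
    1 + (2 * 2 ^ v ∸ 2)              ≡⟨ sym (+-∸-assoc 1 {2 * 2 ^ v} {2} (*-monoʳ-≤ 2 (m^n>0 2 v))) ⟩
    1 + 2 * 2 ^ v ∸ 2                ≡⟨⟩
    2 * 2 ^ v ∸ 1                    ≡⟨ sym (ones≡2^n∸1 (suc v)) ⟩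
    ones (suc v)                     ∎
  where open ≡-Reasoning

-- Packed vectors: n fields of width F in one word, field i holding v i.

pack : ℕ → ℕ → (ℕ → ℕ) → ℕ
pack F zero    v = 0
pack F (suc n) v = v 0 + 2 ^ F * pack F n (λ i → v (suc i))

Below : ℕ → (ℕ → Set) → Set
Below n P = ∀ i → i < n → P i

Fits : ℕ → ℕ → (ℕ → ℕ) → Set
Fits F n v = Below n (λ i → v i < 2 ^ F)

pack-ext : ∀ F n u v → Below n (λ i → u i ≡ v i) → pack F n u ≡ pack F n v
pack-ext F zero    u v h = refl
pack-ext F (suc n) u v h = cong₂ (λ a b → a + 2 ^ F * b) (h 0 (s≤s z≤n))
  (pack-ext F n _ _ (λ i i< → h (suc i) (s≤s i<)))

pack-+ : ∀ F n u v → pack F n u + pack F n v ≡ pack F n (λ i → u i + v i)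
pack-+ F zero    u v = refl
pack-+ F (suc n) u v = begin
    u 0 + 2 ^ F * U + (v 0 + 2 ^ F * V) ≡⟨ interchange (u 0) (v 0) (2 ^ F) U V ⟩
    u 0 + v 0 + 2 ^ F * (U + V)         ≡⟨ cong (λ z → u 0 + v 0 + 2 ^ F * z) (pack-+ F n _ _) ⟩
    u 0 + v 0 + 2 ^ F * pack F n (λ i → u (suc i) + v (suc i)) ∎
  where
  open ≡-Reasoning
  U : ℕ
  U = pack F n (λ i → u (suc i))
  V : ℕ
  V = pack F n (λ i → v (suc i))
  interchange : ∀ a b c x y → a + c * x + (b + c * y) ≡ a + b + c * (x + y)
  interchange = solve-∀

pack-* : ∀ F n c v → c * pack F n v ≡ pack F n (λ i → c * v i)
pack-* F zero    c v = *-zeroʳ c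
pack-* F (suc n) c v = begin
    c * (v 0 + 2 ^ F * V)     ≡⟨ distrib c (v 0) (2 ^ F) V ⟩
    c * v 0 + 2 ^ F * (c * V) ≡⟨ cong (λ z → c * v 0 + 2 ^ F * z) (pack-* F n c _) ⟩
    c * v 0 + 2 ^ F * pack F n (λ i → c * v (suc i)) ∎
  where
  open ≡-Reasoning
  V : ℕ
  V = pack F n (λ i → v (suc i))
  distrib : ∀ c a d x → c * (a + d * x) ≡ c * a + d * (c * x)
  distrib = solve-∀

-- Field-wise ≤ gives ≤ of the words; hence field-wise subtraction never borrows.
pack-mono-≤ : ∀ F n u v → Below n (λ i → u i ≤ v i) → pack F n u ≤ pack F n v
pack-mono-≤ F zero    u v h = z≤n
pack-mono-≤ F (suc n) u v h = +-mono-≤ (h 0 (s≤s z≤n))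
  (*-monoʳ-≤ (2 ^ F) (pack-mono-≤ F n _ _ (λ i i< → h (suc i) (s≤s i<))))

pack-∸ : ∀ F n u v → Below n (λ i → v i ≤ u i) → pack F n u ∸ pack F n v ≡ pack F n (λ i → u i ∸ v i)
pack-∸ F n u v h = begin
    pack F n u ∸ pack F n v                                ≡⟨ cong (_∸ pack F n v) (sym recombine) ⟩
    pack F n (λ i → u i ∸ v i) + pack F n v ∸ pack F n v   ≡⟨ m+n∸n≡m _ (pack F n v) ⟩
    pack F n (λ i → u i ∸ v i)                             ∎
  where
  open ≡-Reasoning
  recombine : pack F n (λ i → u i ∸ v i) + pack F n v ≡ pack F n u
  recombine = trans (pack-+ F n _ _) (pack-ext F n _ _ (λ i i< → m∸n+n≡m (h i i<)))

pack-< : ∀ F n v → Fits F n v → pack F n v < 2 ^ (n * F)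
pack-< F zero    v h = s≤s z≤n
pack-< F (suc n) v h = begin-strict
    v 0 + 2 ^ F * V       <⟨ +-monoˡ-< _ (h 0 (s≤s z≤n)) ⟩
    2 ^ F + 2 ^ F * V     ≡⟨ sym (*-suc (2 ^ F) V) ⟩
    2 ^ F * suc V         ≤⟨ *-monoʳ-≤ (2 ^ F) (pack-< F n _ (λ i i< → h (suc i) (s≤s i<))) ⟩
    2 ^ F * 2 ^ (n * F)   ≡⟨ sym (^-distribˡ-+-* 2 F (n * F)) ⟩
    2 ^ (F + n * F)       ∎
  where
  open ≤-Reasoning
  V : ℕ
  V = pack F n (λ i → v (suc i))

pack-bitwise : ∀ f F n u v → Fits F n u → Fits F n v →
  bitwise f (n * F) (pack F n u) (pack F n v) ≡ pack F n (λ i → bitwise f F (u i) (v i))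
pack-bitwise f F zero    u v hu hv = refl
pack-bitwise f F (suc n) u v hu hv =
  trans (bitwise-split f F (n * F) (u 0) _ (v 0) _ (hu 0 (s≤s z≤n)) (hv 0 (s≤s z≤n)))
        (cong (λ z → bitwise f F (u 0) (v 0) + 2 ^ F * z)
              (pack-bitwise f F n _ _ (λ i i< → hu (suc i) (s≤s i<)) (λ i i< → hv (suc i) (s≤s i<))))

divPow-0 : ∀ x → divPow x 0 ≡ x
divPow-0 x = n/1≡n x

divPow-+ : ∀ x a b → divPow x (a + b) ≡ divPow (divPow x a) b
divPow-+ x a b = begin
    _/_ x (2 ^ (a + b)) {{m^n≢0 2 (a + b)}}
      ≡⟨ /-congʳ {{m^n≢0 2 (a + b)}} {{nz}} (^-distribˡ-+-* 2 a b) ⟩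
    _/_ x (2 ^ a * 2 ^ b) {{nz}}
      ≡⟨ sym (m/n/o≡m/[n*o] x (2 ^ a) (2 ^ b) {{m^n≢0 2 a}} {{m^n≢0 2 b}} {{nz}}) ⟩
    divPow (divPow x a) b ∎
  where
  open ≡-Reasoning
  nz : NonZero (2 ^ a * 2 ^ b)
  nz = subst NonZero (^-distribˡ-+-* 2 a b) (m^n≢0 2 (a + b))

divPow-2^g* : ∀ g X → divPow (2 ^ g * X) g ≡ X
divPow-2^g* g X =
  trans (cong (λ z → _/_ z (2 ^ g) {{m^n≢0 2 g}}) (*-comm (2 ^ g) X)) (m*n/n≡m X (2 ^ g) {{m^n≢0 2 g}})

pack-drop : ∀ F j n v → Fits F (j + n) v →
  divPow (pack F (j + n) v) (j * F) ≡ pack F n (λ i → v (j + i))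
pack-drop F zero    n v h = divPow-0 _
pack-drop F (suc j) n v h = begin
    divPow (pack F (suc (j + n)) v) (F + j * F)          ≡⟨ divPow-+ _ F (j * F) ⟩
    divPow (divPow (pack F (suc (j + n)) v) F) (j * F)   ≡⟨ cong (λ z → divPow z (j * F)) drop-one ⟩
    divPow (pack F (j + n) (λ i → v (suc i))) (j * F)
      ≡⟨ pack-drop F j n (λ i → v (suc i)) (λ i i< → h (suc i) (s≤s i<)) ⟩
    pack F n (λ i → v (suc (j + i)))                     ∎
  where
  open ≡-Reasoning
  V : ℕ
  V = pack F (j + n) (λ i → v (suc i))
  drop-one : divPow (pack F (suc (j + n)) v) F ≡ V
  drop-one = trans (cong (λ z → _/_ (v 0 + z) (2 ^ F) {{m^n≢0 2 F}}) (*-comm (2 ^ F) V))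
                   ([r+q*n]/n≡q (v 0) V (2 ^ F) {{m^n≢0 2 F}} (h 0 (s≤s z≤n)))

pack-pairs : ∀ B F m v → 2 ^ F ≡ 2 ^ B * 2 ^ B →
  pack B (m * 2) v ≡ pack F m (λ i → v (i * 2) + 2 ^ B * v (suc (i * 2)))
pack-pairs B F zero    v eq = refl
pack-pairs B F (suc m) v eq = begin
    v 0 + 2 ^ B * (v 1 + 2 ^ B * P)       ≡⟨ nest (v 0) (v 1) (2 ^ B) P ⟩
    v 0 + 2 ^ B * v 1 + 2 ^ B * 2 ^ B * P
      ≡⟨ cong₂ (λ a b → v 0 + 2 ^ B * v 1 + a * b) (sym eq) (pack-pairs B F m (λ i → v (suc (suc i))) eq) ⟩
    v 0 + 2 ^ B * v 1 + 2 ^ F * pack F m (λ i → v (suc (suc (i * 2))) + 2 ^ B * v (suc (suc (suc (i * 2))))) ∎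
  where
  open ≡-Reasoning
  P : ℕ
  P = pack B (m * 2) (λ i → v (suc (suc i)))
  nest : ∀ a b c x → a + c * (b + c * x) ≡ a + c * b + c * c * x
  nest = solve-∀

module FieldOps (w F n : ℕ) (eq : w ≡ n * F) where

  pack-fits : ∀ v → Fits F n v → pack F n v < 2 ^ w
  pack-fits v h = subst (λ q → pack F n v < 2 ^ q) (sym eq) (pack-< F n v h)

  and-fields : ∀ u v → Fits F n u → Fits F n v →
    andW w (pack F n u) (pack F n v) ≡ pack F n (λ i → andW F (u i) (v i))
  and-fields u v hu hv = trans (cong (λ q → andW q (pack F n u) (pack F n v)) eq) (pack-bitwise _∧_ F n u v hu hv)

  add-fields : ∀ u v → Fits F n (λ i → u i + v i) →
    addW w (pack F n u) (pack F n v) ≡ pack F n (λ i → u i + v i)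
  add-fields u v h =
    trans (add-id w (pack F n u) (pack F n v) (subst (_< 2 ^ w) (sym (pack-+ F n u v)) (pack-fits _ h)))
          (pack-+ F n u v)

  sub-fields : ∀ u v → Fits F n u → Below n (λ i → v i ≤ u i) →
    subW w (pack F n u) (pack F n v) ≡ pack F n (λ i → u i ∸ v i)
  sub-fields u v hu le = trans (sub-id w _ _ (pack-mono-≤ F n v u le) (pack-fits u hu)) (pack-∸ F n u v le)

  const-fields : ∀ v → Fits F n v → wrap w (pack F n v) ≡ pack F n v
  const-fields v h = wrap-id w _ (pack-fits v h)

  shr-fields : ∀ a u → shrW w (pack F n (λ i → 2 ^ a * u i)) a ≡ pack F n u
  shr-fields a u = trans (cong (λ q → divPow q a) (sym (pack-* F n (2 ^ a) u))) (divPow-2^g* a (pack F n u))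

-- Parenthesis statistics of a 0/1 sequence z (1 = closed).

Bits01 : (ℕ → ℕ) → Set
Bits01 z = ∀ i → z i ≤ 1

cl : (ℕ → ℕ) → ℕ → ℕ → ℕ
cl z i zero    = 0
cl z i (suc L) = z i + cl z (suc i) L

-- Maximal closed excess of a prefix of the same block, computed from the right.
md-step : ℕ → ℕ → ℕ
md-step zero    r = r ∸ 1
md-step (suc _) r = suc r

md : (ℕ → ℕ) → ℕ → ℕ → ℕ
md z i zero    = 0
md z i (suc L) = md-step (z i) (md z (suc i) L)

cl-+ : ∀ z i B B' → cl z i (B + B') ≡ cl z i B + cl z (i + B) B'
cl-+ z i zero    B' = cong (λ j → cl z j B') (sym (+-identityʳ i))
cl-+ z i (suc B) B' = begin
    z i + cl z (suc i) (B + B')                        ≡⟨ cong (z i +_) (cl-+ z (suc i) B B') ⟩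
    z i + (cl z (suc i) B + cl z (suc i + B) B')       ≡⟨ sym (+-assoc (z i) _ _) ⟩
    z i + cl z (suc i) B + cl z (suc i + B) B'         ≡⟨ cong (λ j → z i + cl z (suc i) B + cl z j B') (sym (+-suc i B)) ⟩
    z i + cl z (suc i) B + cl z (i + suc B) B'         ∎
  where open ≡-Reasoning

cl-≤ : ∀ z → Bits01 z → ∀ i L → cl z i L ≤ L
cl-≤ z h i zero    = z≤n
cl-≤ z h i (suc L) = +-mono-≤ (h i) (cl-≤ z h (suc i) L)

md-≤ : ∀ z i L → md z i L ≤ L
md-≤ z i zero = z≤n
md-≤ z i (suc L) with z i
... | zero  = ≤-trans (m∸n≤m _ 1) (≤-trans (md-≤ z (suc i) L) (n≤1+n L))
... | suc _ = s≤s (md-≤ z (suc i) L)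

md-one : ∀ z → Bits01 z → ∀ i → md z i 1 ≡ z i
md-one z h i with z i | h i
... | zero        | _ = refl
... | suc zero    | _ = refl
... | suc (suc _) | s≤s ()

-- How one open symbol in front acts on the identity of 'md-combine'.
pred-⊔-shift : ∀ B M m Y → M + B ≡ (m + B) ⊔ Y → (M ∸ 1) + suc B ≡ ((m ∸ 1) + suc B) ⊔ Y
pred-⊔-shift B zero zero Y eq =
  sym (m≥n⇒m⊔n≡m (≤-trans (≤-trans (m≤n⊔m B Y) (≤-reflexive (sym eq))) (n≤1+n B)))
pred-⊔-shift B (suc q) zero Y eq with ≤-total Y B
... | inj₁ Y≤B =
  ⊥-elim (1+n≰n (≤-trans (s≤s (m≤n+m B q)) (≤-trans (≤-reflexive eq) (≤-reflexive (m≥n⇒m⊔n≡m Y≤B)))))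
... | inj₂ B≤Y = begin
    q + suc B   ≡⟨ +-suc q B ⟩
    suc q + B   ≡⟨ eq ⟩
    B ⊔ Y       ≡⟨ m≤n⇒m⊔n≡n B≤Y ⟩
    Y           ≡⟨ sym (m≤n⇒m⊔n≡n B<Y) ⟩
    suc B ⊔ Y   ∎
  where
  open ≡-Reasoning
  B<Y : suc B ≤ Y
  B<Y = ≤-trans (s≤s (m≤n+m B q)) (≤-trans (≤-reflexive eq) (≤-reflexive (m≤n⇒m⊔n≡n B≤Y)))
pred-⊔-shift B zero (suc m) Y eq =
  ⊥-elim (1+n≰n (≤-trans (s≤s (m≤n+m B m)) (≤-trans (m≤m⊔n (suc m + B) Y) (≤-reflexive (sym eq)))))
pred-⊔-shift B (suc q) (suc m) Y eq = trans (+-suc q B) (trans eq (cong (_⊔ Y) (sym (+-suc m B))))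

md-combine : ∀ z → Bits01 z → ∀ i B B' →
  md z i (B + B') + B ≡ (md z i B + B) ⊔ (2 * cl z i B + md z (i + B) B')
md-combine z h i zero B' = trans (+-identityʳ _) (cong (λ j → md z j B') (sym (+-identityʳ i)))
md-combine z h i (suc B) B' with z i | h i | md-combine z h (suc i) B B'
... | suc (suc _) | s≤s () | _
... | suc zero | _ | ih = begin
    suc (md z (suc i) (B + B')) + suc B         ≡⟨ cong suc (+-suc _ B) ⟩
    2 + (md z (suc i) (B + B') + B)             ≡⟨ cong (2 +_) ih ⟩
    2 + ((m + B) ⊔ (2 * c + R))                 ≡⟨ +-distribˡ-⊔ 2 (m + B) _ ⟩
    (2 + (m + B)) ⊔ (2 + (2 * c + R))
      ≡⟨ cong₂ _⊔_ (sym (cong suc (+-suc m B))) (cong (λ j → 2 + (2 * c + md z j B')) (sym (+-suc i B))) ⟩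
    (suc m + suc B) ⊔ (2 + (2 * c + md z (i + suc B) B'))
      ≡⟨ cong (λ q → (suc m + suc B) ⊔ (q + md z (i + suc B) B')) (sym (*-suc 2 c)) ⟩
    (suc m + suc B) ⊔ (2 * (1 + c) + md z (i + suc B) B') ∎
  where
  open ≡-Reasoning
  m : ℕ
  m = md z (suc i) B
  c : ℕ
  c = cl z (suc i) B
  R : ℕ
  R = md z (suc i + B) B'
... | zero | _ | ih =
  trans (pred-⊔-shift B (md z (suc i) (B + B')) (md z (suc i) B) _ ih)
        (cong (λ j → ((md z (suc i) B ∸ 1) + suc B) ⊔ (2 * cl z (suc i) B + md z j B')) (sym (+-suc i B)))

2cl≤L+md : ∀ z → Bits01 z → ∀ i L → 2 * cl z i L ≤ L + md z i L
2cl≤L+md z h i zero = z≤n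
2cl≤L+md z h i (suc L) with z i | h i | 2cl≤L+md z h (suc i) L
... | suc (suc _) | s≤s () | _
... | suc zero | _ | ih = begin
    2 * (1 + c)     ≡⟨ *-suc 2 c ⟩
    2 + 2 * c       ≤⟨ +-monoʳ-≤ 2 ih ⟩
    2 + (L + m)     ≡⟨ cong suc (sym (+-suc L m)) ⟩
    suc L + suc m   ∎
  where
  open ≤-Reasoning
  c : ℕ
  c = cl z (suc i) L
  m : ℕ
  m = md z (suc i) L
... | zero | _ | ih = ≤-trans ih (≤-trans (+-monoʳ-≤ L (m≤1+[m∸1] (md z (suc i) L))) (≤-reflexive (+-suc L _)))
  where
  m≤1+[m∸1] : ∀ m → m ≤ suc (m ∸ 1)
  m≤1+[m∸1] zero    = z≤n
  m≤1+[m∸1] (suc m) = ≤-refl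

md-mono : ∀ z → Bits01 z → ∀ i L L' → md z i L ≤ md z i (L + L')
md-mono z h i L L' =
  +-cancelʳ-≤ L _ _ (≤-trans (m≤m⊔n (md z i L + L) _) (≤-reflexive (sym (md-combine z h i L L'))))

2cl-prefix : ∀ z → Bits01 z → ∀ i j L → j ≤ L → 2 * cl z i j ≤ j + md z i L
2cl-prefix z h i j L j≤L = ≤-trans (2cl≤L+md z h i j)
  (+-monoʳ-≤ j (subst (λ q → md z i j ≤ md z i q) (m+[n∸m]≡n j≤L) (md-mono z h i j (L ∸ j))))

cl-snoc : ∀ z i j → cl z i (suc j) ≡ cl z i j + z (i + j)
cl-snoc z i j = begin
    cl z i (suc j)                ≡⟨ cong (cl z i) (+-comm 1 j) ⟩
    cl z i (j + 1)                ≡⟨ cl-+ z i j 1 ⟩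
    cl z i j + (z (i + j) + 0)    ≡⟨ cong (cl z i j +_) (+-identityʳ _) ⟩
    cl z i j + z (i + j)          ∎
  where open ≡-Reasoning

bit-01 : ∀ x i → bit x i ≡ 0 ⊎ bit x i ≡ 1
bit-01 x i with bit x i | m%n<n (divPow x i) 2
... | 0           | _ = inj₁ refl
... | 1           | _ = inj₂ refl
... | suc (suc _) | s≤s (s≤s ())

closedAt : ℕ → ℕ → ℕ
closedAt x i = 1 ∸ bit x (suc i)

closedAt-01 : ∀ x → Bits01 (closedAt x)
closedAt-01 x i = m∸n≤m 1 (bit x (suc i))

excess-sign : ∀ x i → (if odd? (bit x i) then ℤ.-1ℤ else ℤ.1ℤ) ≡ ℤ.+ (2 * (1 ∸ bit x i)) ℤ.- ℤ.1ℤ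
excess-sign x i with bit x i | bit-01 x i
... | .0 | inj₁ refl = refl
... | .1 | inj₂ refl = refl

-- With s₀ = 1: E(j+1) = #closed − #open among s₀ … s_j = 2·cl(0, j) − (j + 1).
excess≡2cl-[1+j] : ∀ x → bit x 0 ≡ 1 → ∀ j →
  excess x (suc j) ≡ ℤ.+ (2 * cl (closedAt x) 0 j) ℤ.- ℤ.+ (suc j)
excess≡2cl-[1+j] x b0 zero rewrite b0 = refl
excess≡2cl-[1+j] x b0 (suc j) = begin
    excess x (suc j) ℤ.+ (if odd? (bit x (suc j)) then ℤ.-1ℤ else ℤ.1ℤ)
      ≡⟨ cong₂ ℤ._+_ (excess≡2cl-[1+j] x b0 j) (excess-sign x (suc j)) ⟩
    ℤ.+ (2 * c) ℤ.- ℤ.+ (suc j) ℤ.+ (ℤ.+ (2 * t) ℤ.- ℤ.1ℤ)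
      ≡⟨ regroup (ℤ.+ (2 * c)) (ℤ.+ (2 * t)) (ℤ.+ (suc j)) ⟩
    ℤ.+ (2 * c) ℤ.+ ℤ.+ (2 * t) ℤ.- (ℤ.+ (suc j) ℤ.+ ℤ.1ℤ)
      ≡⟨ cong₂ ℤ._-_ (sym (ℤP.pos-+ (2 * c) (2 * t))) (sym (ℤP.pos-+ (suc j) 1)) ⟩
    ℤ.+ (2 * c + 2 * t) ℤ.- ℤ.+ (suc j + 1)
      ≡⟨ cong₂ (λ a b → ℤ.+ a ℤ.- ℤ.+ b) (sym (*-distribˡ-+ 2 c t)) (+-comm (suc j) 1) ⟩
    ℤ.+ (2 * (c + t)) ℤ.- ℤ.+ (suc (suc j))
      ≡⟨ cong (λ q → ℤ.+ (2 * q) ℤ.- ℤ.+ (suc (suc j))) (sym (cl-snoc (closedAt x) 0 j)) ⟩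
    ℤ.+ (2 * cl (closedAt x) 0 (suc j)) ℤ.- ℤ.+ (suc (suc j)) ∎
  where
  open ≡-Reasoning
  c : ℕ
  c = cl (closedAt x) 0 j
  t : ℕ
  t = closedAt x j
  regroup : ∀ (a b n : ℤ.ℤ) → a ℤ.- n ℤ.+ (b ℤ.- ℤ.1ℤ) ≡ a ℤ.+ b ℤ.- (n ℤ.+ ℤ.1ℤ)
  regroup = ℤSolver.solve-∀

+a-+b≡0⇒a≡b : ∀ a b → ℤ.+ a ℤ.- ℤ.+ b ≡ ℤ.0ℤ → a ≡ b
+a-+b≡0⇒a≡b a b eq =
  ℤP.+-injective (trans (cancel (ℤ.+ a) (ℤ.+ b)) (trans (cong (ℤ._+ ℤ.+ b) eq) (ℤP.+-identityˡ (ℤ.+ b))))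
  where
  cancel : ∀ (a b : ℤ.ℤ) → a ≡ a ℤ.- b ℤ.+ b
  cancel = ℤSolver.solve-∀

+a-+a≡0 : ∀ a → ℤ.+ a ℤ.- ℤ.+ a ≡ ℤ.0ℤ
+a-+a≡0 a = ℤP.+-inverseʳ (ℤ.+ a)

-- The values computed so far form a list, most recent first.  An argument is
-- either the r-th most recent value (R r), the value computed a-th from the
-- start (V a, an absolute address), or a constant (K c).

data Arg : Set where
  R V K : ℕ → Arg

data Op : Set where
  AND' OR' XOR' SHL' SHR' SAR' ADD' SUB' : Op

toOp₂ : Op → Op₂
toOp₂ AND' = AND
toOp₂ OR'  = OR
toOp₂ XOR' = XOR
toOp₂ SHL' = SHL
toOp₂ SHR' = SHR
toOp₂ SAR' = SAR
toOp₂ ADD' = ADD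
toOp₂ SUB' = SUB

data Ins : Set where
  NOT : Arg → Ins
  BIN : Op → Arg → Arg → Ins

-- The r-th most recent value, and the value at absolute address a, i.e. the
-- one that was pushed when a values were present.
recent : List ℕ → ℕ → ℕ
recent []      _       = 0
recent (x ∷ L) zero    = x
recent (x ∷ L) (suc r) = recent L r

slot : List ℕ → ℕ → ℕ
slot []      _ = 0
slot (x ∷ L) a = if a ≡ᵇ length L then x else slot L a

evalArg : ℕ → List ℕ → Arg → ℕ
evalArg w L (R r) = recent L r
evalArg w L (V a) = slot L a
evalArg w L (K c) = wrap w c

evalIns : ℕ → List ℕ → Ins → ℕ
evalIns w L (NOT a)     = notW w (evalArg w L a)
evalIns w L (BIN o a b) = evalOp₂ (toOp₂ o) w (evalArg w L a) (evalArg w L b)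

-- The definition is
-- opaque, so that symbolic execution proceeds instruction by instruction
-- through the two equations below rather than by normalisation.
opaque
  exec : ℕ → List ℕ → List Ins → List ℕ
  exec w L []       = L
  exec w L (i ∷ is) = exec w (evalIns w L i ∷ L) is

opaque
  unfolding exec
  exec-[] : ∀ w L → exec w L [] ≡ L
  exec-[] w L = refl

  exec-∷ : ∀ w L i is → exec w L (i ∷ is) ≡ exec w (evalIns w L i ∷ L) is
  exec-∷ w L i is = refl

exec-++ : ∀ w L is js → exec w L (is ++ js) ≡ exec w (exec w L is) js
exec-++ w L []       js rewrite exec-[] w L = refl
exec-++ w L (i ∷ is) js rewrite exec-∷ w L i (is ++ js) | exec-∷ w L i is = exec-++ w (evalIns w L i ∷ L) is js

length-exec : ∀ w L is → length (exec w L is) ≡ length is + length L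
length-exec w L []       rewrite exec-[] w L = refl
length-exec w L (i ∷ is) rewrite exec-∷ w L i is = trans (length-exec w _ is) (+-suc (length is) (length L))

slot-∷ : ∀ x L a → a < length L → slot (x ∷ L) a ≡ slot L a
slot-∷ x L a a< with a ≡ᵇ length L | ≡ᵇ⇒≡ a (length L)
... | false | _ = refl
... | true  | e = ⊥-elim (<-irrefl (e _) a<)

slot-new : ∀ x L → slot (x ∷ L) (length L) ≡ x
slot-new x L with length L ≡ᵇ length L | ≡⇒≡ᵇ (length L) (length L) refl
... | true  | _  = refl
... | false | ()

slot-exec : ∀ w L is a → a < length L → slot (exec w L is) a ≡ slot L a
slot-exec w L []       a a< rewrite exec-[] w L = refl
slot-exec w L (i ∷ is) a a< rewrite exec-∷ w L i is =
  trans (slot-exec w _ is a (≤-trans a< (n≤1+n _))) (slot-∷ _ L a a<)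

run-step : ∀ {w L i is v} {X : ℕ} (f : List ℕ → ℕ) → evalIns w L i ≡ v →
  f (exec w (v ∷ L) is) ≡ X → f (exec w L (i ∷ is)) ≡ X
run-step {w} {L} {i} {is} f refl e = trans (cong f (exec-∷ w L i is)) e

run-step₂ : ∀ {w L i is v} {X Y : ℕ} → evalIns w L i ≡ v →
  recent (exec w (v ∷ L) is) 0 ≡ X × recent (exec w (v ∷ L) is) 1 ≡ Y →
  recent (exec w L (i ∷ is)) 0 ≡ X × recent (exec w L (i ∷ is)) 1 ≡ Y
run-step₂ e (e₀ , e₁) = run-step (λ E → recent E 0) e e₀ , run-step (λ E → recent E 1) e e₁

run-done₂ : ∀ w L {X Y} → recent L 0 ≡ X × recent L 1 ≡ Y →
  recent (exec w L []) 0 ≡ X × recent (exec w L []) 1 ≡ Y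
run-done₂ w L (e₀ , e₁) =
  trans (cong (λ E → recent E 0) (exec-[] w L)) e₀ , trans (cong (λ E → recent E 1) (exec-[] w L)) e₁

-- With n values present, the r-th
-- most recent value is register r, and the value at address a is register
-- n ∸ 1 ∸ a; out-of-range arguments become the constant 0, as in 'recent'/'slot'.

lift : ∀ {n} → Operand n → Operand (suc n)
lift (reg i) = reg (suc i)
lift (imm c) = imm c

relOperand : (n r : ℕ) → Operand n
relOperand zero    r       = imm 0
relOperand (suc n) zero    = reg zero
relOperand (suc n) (suc r) = lift (relOperand n r)

absOperand : (n a : ℕ) → Operand n
absOperand zero    a = imm 0
absOperand (suc n) a = if a ≡ᵇ n then reg zero else lift (absOperand n a)

compileArg : (n : ℕ) → Arg → Operand n
compileArg n (R r) = relOperand n r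
compileArg n (V a) = absOperand n a
compileArg n (K c) = imm c

compileIns : (n : ℕ) → Ins → Instr n
compileIns n (NOT a)     = un (compileArg n a)
compileIns n (BIN o a b) = bin (toOp₂ o) (compileArg n a) (compileArg n b)

compile : (n : ℕ) → List Ins → Arg → SLP n
compile n []       o = ret (compileArg n o)
compile n (i ∷ is) o = compileIns n i ▹ compile (suc n) is o

lift-correct : ∀ w {n} (x : ℕ) (ρ : Vec ℕ n) o → evalOperand w (x Vec.∷ ρ) (lift o) ≡ evalOperand w ρ o
lift-correct w x ρ (reg i) = refl
lift-correct w x ρ (imm c) = refl

length-toList : ∀ {n} (ρ : Vec ℕ n) → length (toList ρ) ≡ n
length-toList Vec.[]       = refl
length-toList (x Vec.∷ ρ) = cong suc (length-toList ρ)

compileArg-correct : ∀ w {n} (ρ : Vec ℕ n) a → evalOperand w ρ (compileArg n a) ≡ evalArg w (toList ρ) a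
compileArg-correct w ρ (R r) = rel ρ r
  where
  rel : ∀ {n} (ρ : Vec ℕ n) r → evalOperand w ρ (relOperand n r) ≡ recent (toList ρ) r
  rel Vec.[]       r       = wrap-0 w
  rel (x Vec.∷ ρ) zero    = refl
  rel (x Vec.∷ ρ) (suc r) = trans (lift-correct w x ρ (relOperand _ r)) (rel ρ r)
compileArg-correct w ρ (V a) = abs ρ
  where
  abs : ∀ {n} (ρ : Vec ℕ n) → evalOperand w ρ (absOperand n a) ≡ slot (toList ρ) a
  abs Vec.[] = wrap-0 w
  abs {suc n} (x Vec.∷ ρ) rewrite length-toList ρ with a ≡ᵇ n
  ... | true  = refl
  ... | false = trans (lift-correct w x ρ (absOperand n a)) (abs ρ)
compileArg-correct w ρ (K c) = refl

compileIns-correct : ∀ w {n} (ρ : Vec ℕ n) i → evalInstr w ρ (compileIns n i) ≡ evalIns w (toList ρ) i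
compileIns-correct w ρ (NOT a)     = cong (notW w) (compileArg-correct w ρ a)
compileIns-correct w ρ (BIN o a b) =
  cong₂ (evalOp₂ (toOp₂ o) w) (compileArg-correct w ρ a) (compileArg-correct w ρ b)

compile-correct : ∀ w {n} (ρ : Vec ℕ n) is o →
  evalSLP w ρ (compile n is o) ≡ evalArg w (exec w (toList ρ) is) o
compile-correct w ρ [] o rewrite exec-[] w (toList ρ) = compileArg-correct w ρ o
compile-correct w ρ (i ∷ is) o rewrite compileIns-correct w ρ i | exec-∷ w (toList ρ) i is =
  compile-correct w (evalIns w (toList ρ) i Vec.∷ ρ) is o

size-compile : ∀ n is o → size (compile n is o) ≡ length is
size-compile n []       o = refl
size-compile n (i ∷ is) o = cong suc (size-compile (suc n) is o)

mulCount-compile : ∀ n is o → mulCount (compile n is o) ≡ 0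
mulCount-compile n []       o = refl
mulCount-compile n (i ∷ is) o = trans (cong (_+ _) (no-mul i)) (mulCount-compile (suc n) is o)
  where
  no-mul : ∀ i → isMul (compileIns n i) ≡ 0
  no-mul (NOT a)        = refl
  no-mul (BIN AND' a b) = refl
  no-mul (BIN OR' a b)  = refl
  no-mul (BIN XOR' a b) = refl
  no-mul (BIN SHL' a b) = refl
  no-mul (BIN SHR' a b) = refl
  no-mul (BIN SAR' a b) = refl
  no-mul (BIN ADD' a b) = refl
  no-mul (BIN SUB' a b) = refl

pair-< : ∀ B B' a b → a < 2 ^ B → b < 2 ^ B' → a + 2 ^ B * b < 2 ^ (B + B')
pair-< B B' a b a< b< = begin-strict
    a + 2 ^ B * b       <⟨ +-monoˡ-< _ a< ⟩
    2 ^ B + 2 ^ B * b   ≡⟨ sym (*-suc (2 ^ B) b) ⟩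
    2 ^ B * suc b       ≤⟨ *-monoʳ-≤ (2 ^ B) b< ⟩
    2 ^ B * 2 ^ B'      ≡⟨ sym (^-distribˡ-+-* 2 B B') ⟩
    2 ^ (B + B')        ∎
  where open ≤-Reasoning

leBit : ℕ → ℕ → ℕ
leBit s t with s ≤? t
... | yes _ = 1
... | no _  = 0

guard-bit : ∀ g s t → s < 2 ^ g → t < 2 ^ g →
  andW (g + 1) (t + 2 ^ g ∸ s) (0 + 2 ^ g * 1) ≡ 2 ^ g * leBit s t
guard-bit g s t s< t< with s ≤? t
... | yes s≤t = begin
    andW (g + 1) (t + 2 ^ g ∸ s) (0 + 2 ^ g * 1)
      ≡⟨ cong (λ q → andW (g + 1) q (0 + 2 ^ g * 1)) no-borrow ⟩
    andW (g + 1) ((t ∸ s) + 2 ^ g * 1) (0 + 2 ^ g * 1)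
      ≡⟨ bitwise-split _∧_ g 1 (t ∸ s) 1 0 1 (≤-<-trans (m∸n≤m t s) t<) (m^n>0 2 g) ⟩
    andW g (t ∸ s) 0 + 2 ^ g * 1
      ≡⟨ cong (_+ 2 ^ g * 1) (and-zeroʳ g (t ∸ s)) ⟩
    2 ^ g * 1 ∎
  where
  open ≡-Reasoning
  no-borrow : t + 2 ^ g ∸ s ≡ (t ∸ s) + 2 ^ g * 1
  no-borrow = trans (+-∸-comm (2 ^ g) s≤t) (cong (t ∸ s +_) (sym (*-identityʳ (2 ^ g))))
... | no s≰t = begin
    andW (g + 1) (t + 2 ^ g ∸ s) (0 + 2 ^ g * 1)
      ≡⟨ cong (λ q → andW (g + 1) q (0 + 2 ^ g * 1)) (x≡x+2^g*0 (t + 2 ^ g ∸ s) g) ⟩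
    andW (g + 1) ((t + 2 ^ g ∸ s) + 2 ^ g * 0) (0 + 2 ^ g * 1)
      ≡⟨ bitwise-split _∧_ g 1 (t + 2 ^ g ∸ s) 0 0 1 (t+2^g∸s<2^g g s t (≰⇒> s≰t)) (m^n>0 2 g) ⟩
    andW g (t + 2 ^ g ∸ s) 0 + 2 ^ g * 0
      ≡⟨ cong (_+ 2 ^ g * 0) (and-zeroʳ g _) ⟩
    2 ^ g * 0 ∎
  where open ≡-Reasoning

-- The mask 2^g·b ∸ b is all ones (b = 1) or zero (b = 0); it selects the maximum.
select-max : ∀ g s t → s < 2 ^ g → t < 2 ^ g →
  andW (g + 1) t (2 ^ g * leBit s t ∸ leBit s t)
    + andW (g + 1) s (ones g ∸ (2 ^ g * leBit s t ∸ leBit s t)) ≡ s ⊔ t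
select-max g s t s< t< with s ≤? t
... | yes s≤t = begin
    andW (g + 1) t (2 ^ g * 1 ∸ 1) + andW (g + 1) s (ones g ∸ (2 ^ g * 1 ∸ 1))
      ≡⟨ cong (λ q → andW (g + 1) t q + andW (g + 1) s (ones g ∸ q)) mask≡ones ⟩
    andW (g + 1) t (ones g) + andW (g + 1) s (ones g ∸ ones g)
      ≡⟨ cong₂ _+_ (and-ones-wide g 1 t t<) (trans (cong (andW (g + 1) s) (n∸n≡0 (ones g))) (and-zeroʳ (g + 1) s)) ⟩
    t + 0 ≡⟨ +-identityʳ t ⟩
    t     ≡⟨ sym (m≤n⇒m⊔n≡n s≤t) ⟩
    s ⊔ t ∎
  where
  open ≡-Reasoning
  mask≡ones : 2 ^ g * 1 ∸ 1 ≡ ones g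
  mask≡ones = trans (cong (_∸ 1) (*-identityʳ (2 ^ g))) (sym (ones≡2^n∸1 g))
... | no s≰t = begin
    andW (g + 1) t (2 ^ g * 0 ∸ 0) + andW (g + 1) s (ones g ∸ (2 ^ g * 0 ∸ 0))
      ≡⟨ cong (λ q → andW (g + 1) t q + andW (g + 1) s (ones g ∸ q)) (*-zeroʳ (2 ^ g)) ⟩
    andW (g + 1) t 0 + andW (g + 1) s (ones g)
      ≡⟨ cong₂ _+_ (and-zeroʳ (g + 1) t) (and-ones-wide g 1 s s<) ⟩
    s     ≡⟨ sym (m≥n⇒m⊔n≡m (<⇒≤ (≰⇒> s≰t))) ⟩
    s ⊔ t ∎
  where open ≡-Reasoning

copies : ℕ → ℕ → ℕ → ℕ
copies F n c = pack F n (λ _ → c)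

copies-fit : ∀ F n c → c < 2 ^ F → Fits F n (λ _ → c)
copies-fit F n c c< _ _ = c<

wrap-copies : ∀ w F n (eq : w ≡ n * F) c → c < 2 ^ F → wrap w (copies F n c) ≡ copies F n c
wrap-copies w F n eq c c< = FieldOps.const-fields w F n eq _ (copies-fit F n c c<)

lowMask highMask : ℕ → ℕ → ℕ
lowMask  B n = copies (2 * B) n (ones B + 2 ^ B * 0)
highMask B n = copies (2 * B) n (0 + 2 ^ B * ones (B + 0))

module Halves (w B n : ℕ) (eqw : w ≡ n * (2 * B)) (B<2^w : B < 2 ^ w)
              (u v : ℕ → ℕ) (u≤ : Below n (λ i → u i ≤ B)) (v≤ : Below n (λ i → v i ≤ B)) where

  F : ℕ
  F = 2 * B

  open FieldOps w F n eqw

  wrap-const : ∀ c → c < 2 ^ F → wrap w (copies F n c) ≡ copies F n c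
  wrap-const = wrap-copies w F n eqw

  ≤B⇒<2^B : ∀ x → x ≤ B → x < 2 ^ B
  ≤B⇒<2^B x x≤ = ≤-<-trans x≤ (n<2^n B)

  ≤B⇒<2^[B+0] : ∀ x → x ≤ B → x < 2 ^ (B + 0)
  ≤B⇒<2^[B+0] x x≤ = subst (λ q → x < 2 ^ q) (sym (+-identityʳ B)) (≤B⇒<2^B x x≤)

  lowMask< : ones B + 2 ^ B * 0 < 2 ^ F
  lowMask< = pair-< B (B + 0) (ones B) 0 (ones<2^n B) (m^n>0 2 (B + 0))

  highMask< : 0 + 2 ^ B * ones (B + 0) < 2 ^ F
  highMask< = pair-< B (B + 0) 0 (ones (B + 0)) (m^n>0 2 B) (ones<2^n (B + 0))

  pairs : ℕ
  pairs = pack F n (λ i → u i + 2 ^ B * v i)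

  pairs-fit : Fits F n (λ i → u i + 2 ^ B * v i)
  pairs-fit i i< = pair-< B (B + 0) (u i) (v i) (≤B⇒<2^B _ (u≤ i i<)) (≤B⇒<2^[B+0] _ (v≤ i i<))

  low-half : andW w pairs (wrap w (lowMask B n)) ≡ pack F n u
  low-half = begin
      andW w pairs (wrap w (lowMask B n))
        ≡⟨ cong (andW w pairs) (wrap-const _ lowMask<) ⟩
      andW w pairs (copies F n (ones B + 2 ^ B * 0))
        ≡⟨ and-fields _ _ pairs-fit (copies-fit F n _ lowMask<) ⟩
      pack F n (λ i → andW F (u i + 2 ^ B * v i) (ones B + 2 ^ B * 0))
        ≡⟨ pack-ext F n _ _ (λ i i< → field-low B (B + 0) (u i) (v i) (≤B⇒<2^B _ (u≤ i i<))) ⟩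
      pack F n u ∎
    where open ≡-Reasoning

  high-half : andW w pairs (wrap w (highMask B n)) ≡ pack F n (λ i → 2 ^ B * v i)
  high-half = begin
      andW w pairs (wrap w (highMask B n))
        ≡⟨ cong (andW w pairs) (wrap-const _ highMask<) ⟩
      andW w pairs (copies F n (0 + 2 ^ B * ones (B + 0)))
        ≡⟨ and-fields _ _ pairs-fit (copies-fit F n _ highMask<) ⟩
      pack F n (λ i → andW F (u i + 2 ^ B * v i) (0 + 2 ^ B * ones (B + 0)))
        ≡⟨ pack-ext F n _ _ (λ i i< → field-high B (B + 0) (u i) (v i)
                                        (≤B⇒<2^B _ (u≤ i i<)) (≤B⇒<2^[B+0] _ (v≤ i i<))) ⟩
      pack F n (λ i → 2 ^ B * v i) ∎
    where open ≡-Reasoning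

  high-shifted : shrW w (pack F n (λ i → 2 ^ B * v i)) (wrap w B) ≡ pack F n v
  high-shifted = trans (cong (shrW w _) (wrap-id w B B<2^w)) (shr-fields B v)

-- One bottom-up level for blocks of length B ≥ 2.
-- The input words hold, in fields of width F = 2B, the pairs
--   C-field = cL + 2^B·cR   and   D-field = dL + 2^B·dR
-- of the statistics cl and md of the two halves of each block of length 2B.
-- The block computes, field-wise, cL + cR and  max(dL + B, 2·cL + dR) ∸ B,
-- the latter with a guard bit g = 2B ∸ 1.  Afterwards the new D word is the
-- most recent value and the new C word the one before it.

levelBlock : (B g n : ℕ) → List Ins
levelBlock B g n =
  BIN AND' (R 1) (K (lowMask B n))  ∷   -- cL
  BIN AND' (R 2) (K (highMask B n)) ∷   -- 2^B·cR
  BIN SHR' (R 0) (K B)              ∷   -- cR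
  BIN AND' (R 3) (K (lowMask B n))  ∷   -- dL
  BIN AND' (R 4) (K (highMask B n)) ∷   -- 2^B·dR
  BIN SHR' (R 0) (K B)              ∷   -- dR
  BIN ADD' (R 2) (K (copies F n B))     ∷   -- S = dL + B
  BIN ADD' (R 6) (R 6)                  ∷   -- cL + cL
  BIN ADD' (R 0) (R 2)                  ∷   -- T = cL + cL + dR
  BIN ADD' (R 0) (K (copies F n (2 ^ g))) ∷ -- T + 2^g
  BIN SUB' (R 0) (R 3)                  ∷   -- T + 2^g ∸ S
  BIN AND' (R 0) (K (copies F n (0 + 2 ^ g * 1))) ∷   -- 2^g·[S ≤ T]
  BIN SHR' (R 0) (K g)                  ∷   -- [S ≤ T]
  BIN SUB' (R 1) (R 0)                  ∷   -- mask: all ones iff S ≤ T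
  BIN SUB' (K (copies F n (ones g))) (R 0) ∷   -- complementary mask
  BIN AND' (R 6) (R 1)                  ∷   -- T if S ≤ T
  BIN AND' (R 9) (R 1)                  ∷   -- S if T < S
  BIN ADD' (R 1) (R 0)                  ∷   -- S ⊔ T
  BIN SUB' (R 0) (K (copies F n B))     ∷   -- new D field: S ⊔ T ∸ B
  BIN ADD' (R 18) (R 16)                ∷   -- new C field: cL + cR
  BIN ADD' (R 1) (K 0)                  ∷   -- copy the new D word to the top
  []
  where
  F : ℕ
  F = 2 * B

-- Verification of 'levelBlock' in a word of width w = n·2B, where the guard
-- bit g = 2B ∸ 1 leaves room for all intermediate field values (at most 3B).
module LevelBlock (w B g n : ℕ) (eqw : w ≡ n * (2 * B)) (eqg : 2 * B ≡ g + 1)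
                  (room : 3 * B + 1 ≤ 2 ^ g) (B<2^w : B < 2 ^ w) (g<2^w : g < 2 ^ w) where

  F : ℕ
  F = 2 * B

  open FieldOps w F n eqw

  wrap-const : ∀ c → c < 2 ^ F → wrap w (copies F n c) ≡ copies F n c
  wrap-const = wrap-copies w F n eqw

  2^F≡2^g+2^g : 2 ^ F ≡ 2 ^ g + 2 ^ g
  2^F≡2^g+2^g = trans (cong (2 ^_) eqg)
    (trans (^-distribˡ-+-* 2 g 1) (trans (*-comm (2 ^ g) 2) (cong (2 ^ g +_) (+-identityʳ (2 ^ g)))))

  <2^g⇒<2^F : ∀ x → x < 2 ^ g → x < 2 ^ F
  <2^g⇒<2^F x x< = subst (x <_) (sym 2^F≡2^g+2^g) (≤-trans x< (m≤m+n (2 ^ g) (2 ^ g)))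

  +2^g<2^F : ∀ x → x < 2 ^ g → x + 2 ^ g < 2 ^ F
  +2^g<2^F x x< = subst (x + 2 ^ g <_) (sym 2^F≡2^g+2^g) (+-monoˡ-< (2 ^ g) x<)

  ≤3B⇒<2^g : ∀ x → x ≤ 3 * B → x < 2 ^ g
  ≤3B⇒<2^g x x≤ = ≤-trans (s≤s x≤) (subst (_≤ 2 ^ g) (+-comm (3 * B) 1) room)

  ≤3B⇒fits : ∀ x → x ≤ 3 * B → x < 2 ^ F
  ≤3B⇒fits x x≤ = <2^g⇒<2^F x (≤3B⇒<2^g x x≤)

  B≤3B : B ≤ 3 * B
  B≤3B = m≤m+n B _

  2B≤3B : B + B ≤ 3 * B
  2B≤3B = +-monoʳ-≤ B (m≤m+n B (B + 0))

  mask-≤ : ∀ s t → 2 ^ g * leBit s t ∸ leBit s t ≤ ones g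
  mask-≤ s t with s ≤? t
  ... | yes _ = ≤-reflexive (trans (cong (_∸ 1) (*-identityʳ (2 ^ g))) (sym (ones≡2^n∸1 g)))
  ... | no _  = subst (_≤ ones g) (sym (*-zeroʳ (2 ^ g))) z≤n

  leBit-≤ : ∀ s t → leBit s t ≤ 2 ^ g * leBit s t
  leBit-≤ s t with s ≤? t
  ... | yes _ = subst (1 ≤_) (sym (*-identityʳ (2 ^ g))) (m^n>0 2 g)
  ... | no _  = z≤n

  guard-≤ : ∀ s t → 2 ^ g * leBit s t ≤ 2 ^ g
  guard-≤ s t with s ≤? t
  ... | yes _ = ≤-reflexive (*-identityʳ (2 ^ g))
  ... | no _  = subst (_≤ 2 ^ g) (sym (*-zeroʳ (2 ^ g))) z≤n

  2^g<2^F : 2 ^ g < 2 ^ F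
  2^g<2^F = subst (2 ^ g <_) (sym 2^F≡2^g+2^g) (m<m+n (2 ^ g) (m^n>0 2 g))

  module Execution (cL cR dL dR : ℕ → ℕ)
                   (cL≤ : Below n (λ i → cL i ≤ B)) (cR≤ : Below n (λ i → cR i ≤ B))
                   (dL≤ : Below n (λ i → dL i ≤ B)) (dR≤ : Below n (λ i → dR i ≤ B))
                   (L0 : List ℕ) where

    open Halves w B n eqw B<2^w cL cR cL≤ cR≤ using ()
      renaming (pairs to C; low-half to C-low; high-half to C-high; high-shifted to C-shift)
    open Halves w B n eqw B<2^w dL dR dL≤ dR≤ using ()
      renaming (pairs to D; low-half to D-low; high-half to D-high; high-shifted to D-shift)

    S T X le mask comask M : ℕ → ℕ
    S i      = dL i + B
    T i      = (cL i + cL i) + dR i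
    X i      = T i + 2 ^ g ∸ S i
    le i     = leBit (S i) (T i)
    mask i   = 2 ^ g * le i ∸ le i
    comask i = ones g ∸ mask i
    M i      = S i ⊔ T i

    S< : Below n (λ i → S i < 2 ^ g)
    S< i i< = ≤3B⇒<2^g _ (≤-trans (+-monoˡ-≤ B (dL≤ i i<)) 2B≤3B)

    T< : Below n (λ i → T i < 2 ^ g)
    T< i i< = ≤3B⇒<2^g _ (≤-trans (+-mono-≤ (+-mono-≤ (cL≤ i i<) (cL≤ i i<)) (dR≤ i i<))
                                   (≤-reflexive (trans (+-assoc B B B) (cong (λ q → B + (B + q)) (sym (+-identityʳ B))))))

    M< : Below n (λ i → M i < 2 ^ F)
    M< i i< = <2^g⇒<2^F _ (⊔-pres-<m (S< i i<) (T< i i<))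

    fits : ∀ v → Below n (λ i → v i < 2 ^ g) → Fits F n v
    fits v h i i< = <2^g⇒<2^F _ (h i i<)

    -- The value pushed by each instruction from the seventh on (the first six
    -- are 'Halves'), named after the value it computes.
    S-ok : addW w (pack F n dL) (wrap w (copies F n B)) ≡ pack F n S
    S-ok = trans (cong (addW w _) (wrap-const B (≤3B⇒fits B B≤3B))) (add-fields dL (λ _ → B) (fits S S<))

    2cL-ok : addW w (pack F n cL) (pack F n cL) ≡ pack F n (λ i → cL i + cL i)
    2cL-ok = add-fields cL cL (λ i i< → ≤3B⇒fits _ (≤-trans (+-mono-≤ (cL≤ i i<) (cL≤ i i<)) 2B≤3B))

    T-ok : addW w (pack F n (λ i → cL i + cL i)) (pack F n dR) ≡ pack F n T
    T-ok = add-fields _ dR (fits T T<)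

    biased-ok : addW w (pack F n T) (wrap w (copies F n (2 ^ g))) ≡ pack F n (λ i → T i + 2 ^ g)
    biased-ok = trans (cong (addW w _) (wrap-const _ 2^g<2^F))
                      (add-fields T (λ _ → 2 ^ g) (λ i i< → +2^g<2^F _ (T< i i<)))

    X-ok : subW w (pack F n (λ i → T i + 2 ^ g)) (pack F n S) ≡ pack F n X
    X-ok = sub-fields _ S (λ i i< → +2^g<2^F _ (T< i i<))
                          (λ i i< → ≤-trans (<⇒≤ (S< i i<)) (m≤n+m (2 ^ g) (T i)))

    guard-ok : andW w (pack F n X) (wrap w (copies F n (0 + 2 ^ g * 1))) ≡ pack F n (λ i → 2 ^ g * le i)
    guard-ok = begin
        andW w (pack F n X) (wrap w (copies F n (0 + 2 ^ g * 1)))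
          ≡⟨ cong (andW w _) (wrap-const _ guard<) ⟩
        andW w (pack F n X) (copies F n (0 + 2 ^ g * 1))
          ≡⟨ and-fields X _ X-fits (copies-fit F n _ guard<) ⟩
        pack F n (λ i → andW F (X i) (0 + 2 ^ g * 1))
          ≡⟨ pack-ext F n _ _ (λ i i< → trans (cong (λ q → andW q (X i) (0 + 2 ^ g * 1)) eqg)
                                                (guard-bit g (S i) (T i) (S< i i<) (T< i i<))) ⟩
        pack F n (λ i → 2 ^ g * le i) ∎
      where
      open ≡-Reasoning
      guard< : 0 + 2 ^ g * 1 < 2 ^ F
      guard< = subst (_< 2 ^ F) (sym (*-identityʳ (2 ^ g))) 2^g<2^F
      X-fits : Fits F n X
      X-fits i i< = ≤-<-trans (m∸n≤m (T i + 2 ^ g) (S i)) (+2^g<2^F _ (T< i i<))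

    le-ok : shrW w (pack F n (λ i → 2 ^ g * le i)) (wrap w g) ≡ pack F n le
    le-ok = trans (cong (shrW w _) (wrap-id w g g<2^w)) (shr-fields g le)

    mask-ok : subW w (pack F n (λ i → 2 ^ g * le i)) (pack F n le) ≡ pack F n mask
    mask-ok = sub-fields _ le (λ i i< → ≤-<-trans (guard-≤ (S i) (T i)) 2^g<2^F) (λ i i< → leBit-≤ (S i) (T i))

    comask-ok : subW w (wrap w (copies F n (ones g))) (pack F n mask) ≡ pack F n comask
    comask-ok = trans (cong (λ q → subW w q (pack F n mask)) (wrap-const _ ones<2^F))
                      (sub-fields _ mask (copies-fit F n _ ones<2^F) (λ i i< → mask-≤ (S i) (T i)))
      where
      ones<2^F : ones g < 2 ^ F
      ones<2^F = <2^g⇒<2^F _ (ones<2^n g)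

    T-sel-ok : andW w (pack F n T) (pack F n mask) ≡ pack F n (λ i → andW F (T i) (mask i))
    T-sel-ok = and-fields T mask (fits T T<) (fits mask (λ i i< → ≤-<-trans (mask-≤ (S i) (T i)) (ones<2^n g)))

    S-sel-ok : andW w (pack F n S) (pack F n comask) ≡ pack F n (λ i → andW F (S i) (comask i))
    S-sel-ok = and-fields S comask (fits S S<) (fits comask (λ i i< → ≤-<-trans (m∸n≤m (ones g) (mask i)) (ones<2^n g)))

    max-ok : addW w (pack F n (λ i → andW F (T i) (mask i))) (pack F n (λ i → andW F (S i) (comask i))) ≡ pack F n M
    max-ok = trans (add-fields _ _ (λ i i< → subst (_< 2 ^ F) (sym (selected i i<)) (M< i i<)))
                   (pack-ext F n _ _ selected)
      where
      selected : Below n (λ i → andW F (T i) (mask i) + andW F (S i) (comask i) ≡ M i)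
      selected i i< = subst (λ q → andW q (T i) (mask i) + andW q (S i) (comask i) ≡ M i) (sym eqg)
                            (select-max g (S i) (T i) (S< i i<) (T< i i<))

    unbias-ok : subW w (pack F n M) (wrap w (copies F n B)) ≡ pack F n (λ i → M i ∸ B)
    unbias-ok = trans (cong (subW w _) (wrap-const B (≤3B⇒fits B B≤3B)))
                      (sub-fields M (λ _ → B) M< (λ i i< → ≤-trans (m≤n+m B (dL i)) (m≤m⊔n (S i) (T i))))

    sum-ok : addW w (pack F n cL) (pack F n cR) ≡ pack F n (λ i → cL i + cR i)
    sum-ok = add-fields cL cR (λ i i< → ≤3B⇒fits _ (≤-trans (+-mono-≤ (cL≤ i i<) (cR≤ i i<)) 2B≤3B))

    copy-ok : addW w (pack F n (λ i → M i ∸ B)) (wrap w 0) ≡ pack F n (λ i → M i ∸ B)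
    copy-ok = trans (cong (addW w _) (wrap-0 w)) (add-0 w _ (pack-fits _ (λ i i< → ≤-<-trans (m∸n≤m (M i) B) (M< i i<))))

    level-block-correct :
      recent (exec w (D ∷ C ∷ L0) (levelBlock B g n)) 0 ≡ pack F n (λ i → M i ∸ B) ×
      recent (exec w (D ∷ C ∷ L0) (levelBlock B g n)) 1 ≡ pack F n (λ i → cL i + cR i)
    level-block-correct =
      run-step₂ C-low    (run-step₂ C-high   (run-step₂ C-shift (run-step₂ D-low (run-step₂ D-high
      (run-step₂ D-shift (run-step₂ S-ok     (run-step₂ 2cL-ok  (run-step₂ T-ok  (run-step₂ biased-ok
      (run-step₂ X-ok    (run-step₂ guard-ok (run-step₂ le-ok   (run-step₂ mask-ok (run-step₂ comask-ok
      (run-step₂ T-sel-ok (run-step₂ S-sel-ok (run-step₂ max-ok (run-step₂ unbias-ok (run-step₂ sum-ok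
      (run-step₂ copy-ok (run-done₂ w _ (refl , refl))))))))))))))))))))))

-- The first level (blocks of length 2), where a guard bit does not fit.
-- The input words both hold the bits z, read as pairs p + 2q; the output
-- fields are p + q and md of the pair, which is (p + q) AND 3p.
firstLevelBlock : ℕ → List Ins
firstLevelBlock n =
  BIN AND' (R 1) (K (lowMask 1 n))  ∷   -- p
  BIN AND' (R 2) (K (highMask 1 n)) ∷   -- 2q
  BIN SHR' (R 0) (K 1)              ∷   -- q
  BIN ADD' (R 2) (R 2)              ∷   -- p + p
  BIN ADD' (R 0) (R 3)              ∷   -- 3p
  BIN ADD' (R 4) (R 2)              ∷   -- new C field: p + q
  BIN AND' (R 0) (R 1)              ∷   -- new D field: md of the pair
  []

md-pair : ∀ z → Bits01 z → ∀ i → andW 2 (z i + z (suc i)) (z i + z i + z i) ≡ md z i 2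
md-pair z h i with z i | h i | z (suc i) | h (suc i)
... | 0 | _ | 0 | _ = refl
... | 0 | _ | 1 | _ = refl
... | 1 | _ | 0 | _ = refl
... | 1 | _ | 1 | _ = refl
... | suc (suc _) | s≤s () | _ | _
... | _ | _ | suc (suc _) | s≤s ()

room-for-guard : ∀ B → 2 ≤ B → 3 * B + 1 ≤ 2 ^ (2 * B ∸ 1)
room-for-guard (suc zero) (s≤s ())
room-for-guard (suc (suc b)) _ = ≤-trans (room b) (^-monoʳ-≤ 2 exponent)
  where
  room : ∀ b → 3 * (2 + b) + 1 ≤ 2 ^ (3 + b)
  room zero    = from-yes (7 ≤? 8)
  room (suc b) = begin
      3 * (2 + suc b) + 1         ≡⟨ step b ⟩
      (3 * (2 + b) + 1) + 3       ≤⟨ +-monoˡ-≤ 3 (room b) ⟩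
      2 ^ (3 + b) + 3
        ≤⟨ +-monoʳ-≤ (2 ^ (3 + b)) (≤-trans (from-yes (3 ≤? 8)) (^-monoʳ-≤ 2 {3} {3 + b} (m≤m+n 3 b))) ⟩
      2 ^ (3 + b) + 2 ^ (3 + b)   ≡⟨ cong (2 ^ (3 + b) +_) (sym (+-identityʳ _)) ⟩
      2 ^ (3 + suc b)             ∎
    where
    open ≤-Reasoning
    step : ∀ b → 3 * (2 + suc b) + 1 ≡ (3 * (2 + b) + 1) + 3
    step = solve-∀
  exponent : 3 + b ≤ 2 * suc (suc b) ∸ 1
  exponent = ≤-trans (m≤m+n (3 + b) (b + 0))
                     (≤-reflexive (cong suc (sym (trans (+-suc b (suc (b + 0))) (cong suc (+-suc b (b + 0)))))))

guardBit : ℕ → ℕ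
guardBit ℓ = 2 * 2 ^ ℓ ∸ 1

-- The preamble: y = x >> 1 (the bits after position 0), C₀ = NOT y (the closed
-- indicators z), and a copy D₀ of C₀ (for single symbols md = cl).
preamble : List Ins
preamble = BIN SHR' (R 0) (K 1) ∷ NOT (R 0) ∷ BIN ADD' (R 0) (K 0) ∷ []

pack-bits : ∀ n x → x < 2 ^ n → pack 1 n (bit x) ≡ x
pack-bits zero    zero    _ = refl
pack-bits zero    (suc x) (s≤s ())
pack-bits (suc n) x x< = begin
    bit x 0 + 2 * pack 1 n (λ i → bit x (suc i))
      ≡⟨ cong₂ (λ a b → a + 2 * b) (cong (_% 2) (divPow-0 x)) (pack-ext 1 n _ _ (λ i _ → cong (_% 2) (divPow-+ x 1 i))) ⟩
    x % 2 + 2 * pack 1 n (bit (x / 2))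
      ≡⟨ cong (λ q → x % 2 + 2 * q) (pack-bits n (x / 2) (half-< x n x<)) ⟩
    x % 2 + 2 * (x / 2)
      ≡⟨ sym (x≡x%2+2[x/2] x) ⟩
    x ∎
  where open ≡-Reasoning

-- The all-ones word is the vector of ones, so complement acts bit by bit.
ones≡pack-1 : ∀ n → ones n ≡ pack 1 n (λ _ → 1)
ones≡pack-1 zero    = refl
ones≡pack-1 (suc n) = cong (λ q → 1 + 2 * q) (ones≡pack-1 n)

bit-≤1 : ∀ x i → bit x i ≤ 1
bit-≤1 x i with bit-01 x i
... | inj₁ e = ≤-trans (≤-reflexive e) z≤n
... | inj₂ e = ≤-reflexive e

module Words (k x : ℕ) (x< : x < 2 ^ (2 ^ k)) where

  w : ℕ
  w = 2 ^ k

  z : ℕ → ℕ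
  z = closedAt x

  z-01 : Bits01 z
  z-01 = closedAt-01 x

  C D : ℕ → ℕ
  C ℓ = pack (2 ^ ℓ) (2 ^ (k ∸ ℓ)) (λ j → cl z (j * 2 ^ ℓ) (2 ^ ℓ))
  D ℓ = pack (2 ^ ℓ) (2 ^ (k ∸ ℓ)) (λ j → md z (j * 2 ^ ℓ) (2 ^ ℓ))

  w≥1 : 1 ≤ w
  w≥1 = m^n>0 2 k

  1<2^w : 1 < 2 ^ w
  1<2^w = ≤-<-trans w≥1 (n<2^n w)

  fields-cover : ∀ ℓ → ℓ ≤ k → 2 ^ (k ∸ ℓ) * 2 ^ ℓ ≡ w
  fields-cover ℓ le = trans (sym (^-distribˡ-+-* 2 (k ∸ ℓ) ℓ)) (cong (2 ^_) (m∸n+n≡m le))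

  level-fits : ∀ ℓ → ℓ ≤ k → (v : ℕ → ℕ) → (∀ i → v i ≤ 2 ^ ℓ) → pack (2 ^ ℓ) (2 ^ (k ∸ ℓ)) v < 2 ^ w
  level-fits ℓ le v h =
    FieldOps.pack-fits w (2 ^ ℓ) (2 ^ (k ∸ ℓ)) (sym (fields-cover ℓ le)) v (λ i _ → ≤-<-trans (h i) (n<2^n (2 ^ ℓ)))

  C-fits : ∀ ℓ → ℓ ≤ k → C ℓ < 2 ^ w
  C-fits ℓ le = level-fits ℓ le (λ j → cl z (j * 2 ^ ℓ) (2 ^ ℓ)) (λ j → cl-≤ z z-01 (j * 2 ^ ℓ) (2 ^ ℓ))

  level-pairs : ∀ ℓ → ℓ < k → (v : ℕ → ℕ) →
    pack (2 ^ ℓ) (2 ^ (k ∸ ℓ)) v ≡ pack (2 ^ suc ℓ) (2 ^ (k ∸ suc ℓ)) (λ i → v (i * 2) + 2 ^ (2 ^ ℓ) * v (suc (i * 2)))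
  level-pairs ℓ lt v =
    trans (cong (λ q → pack (2 ^ ℓ) q v) (trans (cong (2 ^_) (k∸ℓ≡1+k∸[1+ℓ] ℓ k lt)) (*-comm 2 (2 ^ (k ∸ suc ℓ)))))
          (pack-pairs (2 ^ ℓ) (2 ^ suc ℓ) (2 ^ (k ∸ suc ℓ)) v
             (trans (^-distribˡ-+-* 2 (2 ^ ℓ) (2 ^ ℓ + 0)) (cong (λ q → 2 ^ (2 ^ ℓ) * 2 ^ q) (+-identityʳ (2 ^ ℓ)))))
    where
    k∸ℓ≡1+k∸[1+ℓ] : ∀ ℓ k → ℓ < k → k ∸ ℓ ≡ suc (k ∸ suc ℓ)
    k∸ℓ≡1+k∸[1+ℓ] zero    (suc k) _        = refl
    k∸ℓ≡1+k∸[1+ℓ] (suc ℓ) (suc k) (s≤s lt) = k∸ℓ≡1+k∸[1+ℓ] ℓ k lt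

  y : ℕ
  y = divPow x 1

  not-y≡C₀ : notW w y ≡ C 0
  not-y≡C₀ = begin
      (2 ^ w ∸ 1) ∸ y
        ≡⟨ cong₂ _∸_ (trans (sym (ones≡2^n∸1 w)) (ones≡pack-1 w)) (sym (pack-bits w y (≤-<-trans (m/n≤m x 2) x<))) ⟩
      pack 1 w (λ _ → 1) ∸ pack 1 w (bit y)
        ≡⟨ pack-∸ 1 w _ _ (λ i _ → bit-≤1 y i) ⟩
      pack 1 w (λ i → 1 ∸ bit y i)
        ≡⟨ pack-ext 1 w _ _ (λ i _ → trans (cong (λ q → 1 ∸ q % 2) (sym (divPow-+ x 1 i)))
                                            (sym (trans (+-identityʳ (z (i * 1))) (cong z (*-identityʳ i))))) ⟩
      C 0 ∎
    where open ≡-Reasoning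

  D₀≡C₀ : D 0 ≡ C 0
  D₀≡C₀ = pack-ext 1 w _ _ (λ i _ → trans (md-one z z-01 (i * 1)) (sym (+-identityʳ _)))

  preamble-correct : exec w (x ∷ []) preamble ≡ D 0 ∷ C 0 ∷ y ∷ x ∷ []
  preamble-correct = begin
      exec w (x ∷ []) preamble
        ≡⟨ exec-∷ w _ _ _ ⟩
      exec w (shrW w x (wrap w 1) ∷ x ∷ []) rest
        ≡⟨ cong (λ q → exec w (divPow x q ∷ x ∷ []) rest) (wrap-id w 1 1<2^w) ⟩
      exec w (y ∷ x ∷ []) rest
        ≡⟨ exec-∷ w _ _ _ ⟩
      exec w (notW w y ∷ y ∷ x ∷ []) copy
        ≡⟨ cong (λ q → exec w (q ∷ y ∷ x ∷ []) copy) not-y≡C₀ ⟩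
      exec w (C 0 ∷ y ∷ x ∷ []) copy
        ≡⟨ trans (exec-∷ w _ _ _) (exec-[] w _) ⟩
      addW w (C 0) (wrap w 0) ∷ C 0 ∷ y ∷ x ∷ []
        ≡⟨ cong (λ q → q ∷ C 0 ∷ y ∷ x ∷ []) copied ⟩
      D 0 ∷ C 0 ∷ y ∷ x ∷ [] ∎
    where
    open ≡-Reasoning
    rest : List Ins
    rest = NOT (R 0) ∷ BIN ADD' (R 0) (K 0) ∷ []
    copy : List Ins
    copy = BIN ADD' (R 0) (K 0) ∷ []
    copied : addW w (C 0) (wrap w 0) ≡ D 0
    copied = trans (cong (addW w (C 0)) (wrap-0 w))
                   (trans (add-0 w (C 0) (C-fits 0 z≤n)) (sym D₀≡C₀))

  module FirstLevel (k≥1 : 1 ≤ k) (L0 : List ℕ) where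

    n : ℕ
    n = 2 ^ (k ∸ 1)

    eqw : w ≡ n * 2
    eqw = sym (fields-cover 1 k≥1)

    open FieldOps w 2 n eqw

    p q : ℕ → ℕ
    p i = z (i * 2)
    q i = z (suc (i * 2))

    p≤ : ∀ i → p i ≤ 1
    p≤ i = z-01 (i * 2)

    q≤ : ∀ i → q i ≤ 1
    q≤ i = z-01 (suc (i * 2))

    open Halves w 1 n eqw 1<2^w p q (λ i _ → p≤ i) (λ i _ → q≤ i)
      using (pairs; low-half; high-half; high-shifted)

    z-field : ∀ j → z j ≡ cl z (j * 1) 1
    z-field j = sym (trans (+-identityʳ _) (cong z (*-identityʳ j)))

    level0≡pairs : C 0 ≡ pairs
    level0≡pairs = trans (pack-ext 1 w _ _ (λ j _ → sym (z-field j)))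
                         (trans (level-pairs 0 k≥1 z) (pack-ext 2 n _ _ (λ i _ → refl)))

    ≤3⇒fits : ∀ (u : ℕ → ℕ) → (∀ i → u i ≤ 3) → Fits 2 n u
    ≤3⇒fits u h i _ = s≤s (h i)

    2p-ok : addW w (pack 2 n p) (pack 2 n p) ≡ pack 2 n (λ i → p i + p i)
    2p-ok = add-fields p p (≤3⇒fits _ (λ i → ≤-trans (+-mono-≤ (p≤ i) (p≤ i)) (s≤s (s≤s z≤n))))

    3p-ok : addW w (pack 2 n (λ i → p i + p i)) (pack 2 n p) ≡ pack 2 n (λ i → p i + p i + p i)
    3p-ok = add-fields _ p (≤3⇒fits _ (λ i → +-mono-≤ (+-mono-≤ (p≤ i) (p≤ i)) (p≤ i)))

    p+q≤3 : ∀ i → p i + q i ≤ 3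
    p+q≤3 i = ≤-trans (+-mono-≤ (p≤ i) (q≤ i)) (s≤s (s≤s z≤n))

    sum-ok : addW w (pack 2 n p) (pack 2 n q) ≡ pack 2 n (λ i → p i + q i)
    sum-ok = add-fields p q (≤3⇒fits _ p+q≤3)

    md-ok : andW w (pack 2 n (λ i → p i + q i)) (pack 2 n (λ i → p i + p i + p i))
          ≡ pack 2 n (λ i → andW 2 (p i + q i) (p i + p i + p i))
    md-ok = and-fields _ _ (≤3⇒fits _ p+q≤3) (≤3⇒fits _ (λ i → +-mono-≤ (+-mono-≤ (p≤ i) (p≤ i)) (p≤ i)))

    C₁-ok : pack 2 n (λ i → p i + q i) ≡ C 1
    C₁-ok = pack-ext 2 n _ _ (λ i _ → cong (λ t → z (i * 2) + t) (sym (+-identityʳ _)))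

    D₁-ok : pack 2 n (λ i → andW 2 (p i + q i) (p i + p i + p i)) ≡ D 1
    D₁-ok = pack-ext 2 n _ _ (λ i _ → md-pair z z-01 (i * 2))

    first-level-correct :
      recent (exec w (D 0 ∷ C 0 ∷ L0) (firstLevelBlock n)) 0 ≡ D 1 ×
      recent (exec w (D 0 ∷ C 0 ∷ L0) (firstLevelBlock n)) 1 ≡ C 1
    first-level-correct rewrite D₀≡C₀ | level0≡pairs =
      run-step₂ low-half (run-step₂ high-half (run-step₂ high-shifted (run-step₂ 2p-ok
      (run-step₂ 3p-ok (run-step₂ sum-ok (run-step₂ md-ok (run-done₂ w _ (D₁-ok , C₁-ok))))))))

  module NextLevel (ℓ : ℕ) (ℓ≥1 : 1 ≤ ℓ) (lt : suc ℓ < k) (L0 : List ℕ) where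

    B g n : ℕ
    B = 2 ^ ℓ
    g = guardBit ℓ
    n = 2 ^ (k ∸ suc ℓ)

    B≥2 : 2 ≤ B
    B≥2 = ^-monoʳ-≤ 2 ℓ≥1

    ℓ<k : ℓ < k
    ℓ<k = ≤-trans (n≤1+n (suc ℓ)) lt

    eqg : 2 * B ≡ g + 1
    eqg = sym (m∸n+n≡m (≤-trans (s≤s z≤n) (≤-trans B≥2 (m≤m+n B (B + 0)))))

    B<2^w : B < 2 ^ w
    B<2^w = ≤-<-trans (^-monoʳ-≤ 2 (<⇒≤ ℓ<k)) (n<2^n w)

    g<2^w : g < 2 ^ w
    g<2^w = ≤-<-trans (≤-trans (m∸n≤m (2 * B) 1) (^-monoʳ-≤ 2 {suc ℓ} {k} (<⇒≤ lt))) (n<2^n w)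

    cl-at md-at : ℕ → ℕ
    cl-at j = cl z (j * B) B
    md-at j = md z (j * B) B

    open LevelBlock w B g n (sym (fields-cover (suc ℓ) (<⇒≤ lt))) eqg (room-for-guard B B≥2) B<2^w g<2^w
    open Execution (λ i → cl-at (i * 2)) (λ i → cl-at (suc (i * 2))) (λ i → md-at (i * 2)) (λ i → md-at (suc (i * 2)))
                   (λ i _ → cl-≤ z z-01 _ _) (λ i _ → cl-≤ z z-01 _ _) (λ i _ → md-≤ z _ _) (λ i _ → md-≤ z _ _) L0

    start : ℕ → ℕ
    start i = i * F

    left-start : ∀ i → i * 2 * B ≡ start i
    left-start i = *-assoc i 2 B

    right-start : ∀ i → suc (i * 2) * B ≡ start i + B
    right-start i = trans (+-comm B (i * 2 * B)) (cong (_+ B) (left-start i))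

    C-next : pack F n (λ i → cl-at (i * 2) + cl-at (suc (i * 2))) ≡ C (suc ℓ)
    C-next = pack-ext F n _ _ (λ i _ → sym (begin
        cl z (start i) (B + (B + 0))                 ≡⟨ cl-+ z (start i) B (B + 0) ⟩
        cl z (start i) B + cl z (start i + B) (B + 0)
          ≡⟨ cong₂ _+_ (cong (λ q → cl z q B) (sym (left-start i)))
                       (cong₂ (cl z) (sym (right-start i)) (+-identityʳ B)) ⟩
        cl-at (i * 2) + cl-at (suc (i * 2))          ∎))
      where open ≡-Reasoning

    D-field : ∀ i → M i ∸ B ≡ md z (start i) F
    D-field i = begin
        M i ∸ B                                  ≡⟨ cong (_∸ B) M≡ ⟩
        (md z (start i) (B + (B + 0)) + B) ∸ B   ≡⟨ m+n∸n≡m _ B ⟩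
        md z (start i) F                         ∎
      where
      open ≡-Reasoning
      2cl≡ : 2 * cl z (start i) B ≡ cl-at (i * 2) + cl-at (i * 2)
      2cl≡ = trans (cong (cl z (start i) B +_) (+-identityʳ _))
                   (cong (λ q → cl z q B + cl z q B) (sym (left-start i)))
      M≡ : M i ≡ md z (start i) (B + (B + 0)) + B
      M≡ = sym (trans (md-combine z z-01 (start i) B (B + 0))
                 (cong₂ _⊔_ (cong (λ q → md z q B + B) (sym (left-start i)))
                            (cong₂ _+_ 2cl≡ (cong₂ (md z) (sym (right-start i)) (+-identityʳ B)))))

    next-level-correct :
      recent (exec w (D ℓ ∷ C ℓ ∷ L0) (levelBlock B g n)) 0 ≡ D (suc ℓ) ×
      recent (exec w (D ℓ ∷ C ℓ ∷ L0) (levelBlock B g n)) 1 ≡ C (suc ℓ)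
    next-level-correct rewrite level-pairs ℓ ℓ<k cl-at | level-pairs ℓ ℓ<k md-at =
      trans (proj₁ level-block-correct) (pack-ext F n _ _ (λ i _ → D-field i)) ,
      trans (proj₂ level-block-correct) C-next

-- The bottom-up phase.

bottomUp : ℕ → ℕ → List Ins
bottomUp k 0             = []
bottomUp k 1             = firstLevelBlock (2 ^ (k ∸ 1))
bottomUp k (suc (suc j)) = bottomUp k (suc j) ++ levelBlock (2 ^ suc j) (guardBit (suc j)) (2 ^ (k ∸ suc (suc j)))

-- Number of values after the preamble and the levels up to ℓ; the words D ℓ
-- and C ℓ sit at the absolute addresses addrD ℓ and addrC ℓ.
stored : ℕ → ℕ
stored 0             = 4
stored 1             = 11
stored (suc (suc j)) = stored (suc j) + 21

addrD addrC : ℕ → ℕ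
addrD ℓ = stored ℓ ∸ 1
addrC ℓ = stored ℓ ∸ 2

stored-step : ∀ m → stored m ≤ stored (suc m)
stored-step 0       = from-yes (4 ≤? 11)
stored-step (suc m) = m≤m+n _ 21

stored-≥4 : ∀ ℓ → 4 ≤ stored ℓ
stored-≥4 0       = ≤-refl
stored-≥4 (suc ℓ) = ≤-trans (stored-≥4 ℓ) (stored-step ℓ)

stored-mono : ∀ j ℓ → j ≤ ℓ → stored j ≤ stored ℓ
stored-mono j ℓ le with m≤n⇒∃[o]m+o≡n le
... | o , refl = go j o
  where
  go : ∀ j o → stored j ≤ stored (j + o)
  go j zero    = ≤-reflexive (cong stored (sym (+-identityʳ j)))
  go j (suc o) = ≤-trans (go j o) (≤-trans (stored-step (j + o)) (≤-reflexive (cong stored (sym (+-suc j o)))))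

addrD<stored : ∀ j → addrD j < stored j
addrD<stored j with stored j | stored-≥4 j
... | suc n | _ = n<1+n n

addrC<addrD : ∀ j → addrC j < addrD j
addrC<addrD j with stored j | stored-≥4 j
... | suc (suc n) | _        = n<1+n n
... | suc zero    | s≤s ()

top-two : ∀ (E : List ℕ) → 2 ≤ length E → E ≡ recent E 0 ∷ recent E 1 ∷ drop 2 E
top-two (a ∷ b ∷ L) _ = refl
top-two (a ∷ [])    (s≤s ())

top-slots : ∀ (E : List ℕ) {n} → length E ≡ n → 2 ≤ n →
  slot E (n ∸ 1) ≡ recent E 0 × slot E (n ∸ 2) ≡ recent E 1
top-slots (a ∷ b ∷ L) refl _ = slot-new a (b ∷ L) , trans (slot-∷ a (b ∷ L) (length L) (n<1+n _)) (slot-new b L)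
top-slots (a ∷ [])    refl (s≤s ())

module BottomUp (k x : ℕ) (x< : x < 2 ^ (2 ^ k)) where

  open Words k x x<

  values : ℕ → List ℕ
  values ℓ = exec w (x ∷ []) (preamble ++ bottomUp k ℓ)

  record Computed (ℓ : ℕ) : Set where
    field
      length-ok : length (values ℓ) ≡ stored ℓ
      top-D     : recent (values ℓ) 0 ≡ D ℓ
      top-C     : recent (values ℓ) 1 ≡ C ℓ
      in-slots  : ∀ j → j ≤ ℓ → slot (values ℓ) (addrD j) ≡ D j × slot (values ℓ) (addrC j) ≡ C j

  values-0 : values 0 ≡ D 0 ∷ C 0 ∷ y ∷ x ∷ []
  values-0 = trans (cong (exec w (x ∷ [])) (List.++-identityʳ preamble)) preamble-correct

  computed-0 : Computed 0
  computed-0 = record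
    { length-ok = cong length values-0
    ; top-D     = cong (λ q → recent q 0) values-0
    ; top-C     = cong (λ q → recent q 1) values-0
    ; in-slots  = λ { zero _ → cong (λ q → slot q 3) values-0 , cong (λ q → slot q 2) values-0 }
    }

  extend : ∀ ℓ (blk : List Ins) → Computed ℓ →
    (∀ L0 → recent (exec w (D ℓ ∷ C ℓ ∷ L0) blk) 0 ≡ D (suc ℓ) ×
            recent (exec w (D ℓ ∷ C ℓ ∷ L0) blk) 1 ≡ C (suc ℓ)) →
    values (suc ℓ) ≡ exec w (values ℓ) blk → stored (suc ℓ) ≡ length blk + stored ℓ → Computed (suc ℓ)
  extend ℓ blk inv blk-ok values≡ stored≡ = record
    { length-ok = length-ok′ ; top-D = top-D′ ; top-C = top-C′ ; in-slots = in-slots′ }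
    where
    open Computed inv
    rest : List ℕ
    rest = drop 2 (values ℓ)
    on-top : values ℓ ≡ D ℓ ∷ C ℓ ∷ rest
    on-top = trans (top-two (values ℓ) (≤-trans (s≤s (s≤s z≤n)) (≤-trans (stored-≥4 ℓ) (≤-reflexive (sym length-ok)))))
                   (cong₂ (λ u v → u ∷ v ∷ rest) top-D top-C)
    values≡′ : values (suc ℓ) ≡ exec w (D ℓ ∷ C ℓ ∷ rest) blk
    values≡′ = trans values≡ (cong (λ q → exec w q blk) on-top)
    length-ok′ : length (values (suc ℓ)) ≡ stored (suc ℓ)
    length-ok′ = trans (cong length values≡)
                       (trans (length-exec w (values ℓ) blk) (trans (cong (length blk +_) length-ok) (sym stored≡)))
    top-D′ : recent (values (suc ℓ)) 0 ≡ D (suc ℓ)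
    top-D′ = trans (cong (λ q → recent q 0) values≡′) (proj₁ (blk-ok rest))
    top-C′ : recent (values (suc ℓ)) 1 ≡ C (suc ℓ)
    top-C′ = trans (cong (λ q → recent q 1) values≡′) (proj₂ (blk-ok rest))
    in-slots′ : ∀ j → j ≤ suc ℓ → slot (values (suc ℓ)) (addrD j) ≡ D j × slot (values (suc ℓ)) (addrC j) ≡ C j
    in-slots′ j j≤ with j ≟ suc ℓ
    ... | yes refl =
      let tops = top-slots (values (suc ℓ)) length-ok′ (≤-trans (s≤s (s≤s z≤n)) (stored-≥4 (suc ℓ)))
      in trans (proj₁ tops) top-D′ , trans (proj₂ tops) top-C′
    ... | no j≢ =
      trans (cong (λ q → slot q (addrD j)) values≡)
            (trans (slot-exec w (values ℓ) blk (addrD j) addrD<) (proj₁ (in-slots j j≤ℓ))) ,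
      trans (cong (λ q → slot q (addrC j)) values≡)
            (trans (slot-exec w (values ℓ) blk (addrC j) (<-trans (addrC<addrD j) addrD<)) (proj₂ (in-slots j j≤ℓ)))
      where
      j≤ℓ : j ≤ ℓ
      j≤ℓ = ≤-pred (≤∧≢⇒< j≤ j≢)
      addrD< : addrD j < length (values ℓ)
      addrD< = subst (addrD j <_) (sym length-ok) (≤-trans (addrD<stored j) (stored-mono j ℓ j≤ℓ))

  computed : ∀ ℓ → ℓ < k → Computed ℓ
  computed zero          _  = computed-0
  computed (suc zero)    lt = extend 0 (firstLevelBlock (2 ^ (k ∸ 1))) computed-0
    (FirstLevel.first-level-correct (<⇒≤ lt))
    (trans (exec-++ w (x ∷ []) preamble _)
           (cong (λ q → exec w q (firstLevelBlock (2 ^ (k ∸ 1)))) (cong (exec w (x ∷ [])) (sym (List.++-identityʳ preamble)))))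
    refl
  computed (suc (suc j)) lt = extend (suc j) blk (computed (suc j) (≤-trans (n≤1+n _) lt))
    (NextLevel.next-level-correct (suc j) (s≤s z≤n) lt)
    (trans (cong (exec w (x ∷ [])) (sym (List.++-assoc preamble (bottomUp k (suc j)) blk)))
           (exec-++ w (x ∷ []) (preamble ++ bottomUp k (suc j)) blk))
    (+-comm (stored (suc j)) 21)
    where
    blk : List Ins
    blk = levelBlock (2 ^ suc j) (guardBit (suc j)) (2 ^ (k ∸ suc (suc j)))

-- The top-down phase.

-- Comparing d with h without a branch: the sign of d ∸ h (computed with
-- borrow in a (v+1)-bit word) spread over the word by an arithmetic shift.
sign-mask-clear : ∀ W v → W ≡ suc v → ∀ d h → h ≤ d → d < 2 ^ v →
  sarW W (subW W d h) (wrap W v) ≡ 0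
sign-mask-clear _ v refl d h h≤d d< = begin
    sarW (suc v) (subW (suc v) d h) (wrap (suc v) v)
      ≡⟨ cong₂ (sarW (suc v)) (sub-id (suc v) d h h≤d (<-trans d< (^-monoʳ-< 2 (s≤s (s≤s z≤n)) (n<1+n v))))
                               (wrap-id (suc v) v (<-trans (n<2^n v) (^-monoʳ-< 2 (s≤s (s≤s z≤n)) (n<1+n v)))) ⟩
    sarW (suc v) (d ∸ h) v
      ≡⟨ sar-top-clear v (d ∸ h) (≤-<-trans (m∸n≤m d h) d<) ⟩
    0 ∎
  where open ≡-Reasoning

sign-mask-set : ∀ W v → W ≡ suc v → ∀ d h → d < h → h ≤ 2 ^ v →
  sarW W (subW W d h) (wrap W v) ≡ ones W
sign-mask-set _ v refl d h d<h h≤ =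
  trans (cong (sarW (suc v) (subW (suc v) d h)) (wrap-id (suc v) v (<-trans (n<2^n v) (^-monoʳ-< 2 (s≤s (s≤s z≤n)) (n<1+n v)))))
        (sar-top-set v _ top-set (wrap-< (suc v) (d + (2 ^ suc v ∸ h))))
  where
  h≤2^w : h ≤ 2 ^ suc v
  h≤2^w = ≤-trans h≤ (m≤m+n (2 ^ v) (2 ^ v + 0))
  borrow : subW (suc v) d h ≡ d + (2 ^ suc v ∸ h)
  borrow = sub-borrow (suc v) d h d<h h≤2^w
  top-set : 2 ^ v ≤ subW (suc v) d h
  top-set = subst (2 ^ v ≤_) (sym borrow) (begin
      2 ^ v                         ≡⟨ sym (m+n∸n≡m (2 ^ v) (2 ^ v)) ⟩
      2 ^ v + 2 ^ v ∸ 2 ^ v         ≤⟨ ∸-monoʳ-≤ (2 ^ v + 2 ^ v) h≤ ⟩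
      2 ^ v + 2 ^ v ∸ h             ≡⟨ cong (λ q → 2 ^ v + q ∸ h) (sym (+-identityʳ (2 ^ v))) ⟩
      2 ^ suc v ∸ h                 ≤⟨ m≤n+m (2 ^ suc v ∸ h) d ⟩
      d + (2 ^ suc v ∸ h)           ∎)
    where open ≤-Reasoning

-- One descent step at a level with block length B, from the state (h, p) on
-- top of the stored words (D at address aD, C at address aC).  It reads
-- d = md and c = cl of the block of length B at p; if h ≤ d the match lies
-- in that block and the state stays, otherwise the state moves past it:
-- (h, p) := (h + B ∸ 2c, p + B).
descendBlock : (B aD aC v : ℕ) → List Ins
descendBlock B aD aC v =
  BIN SHR' (V aD) (R 1)       ∷   -- D >> p
  BIN AND' (R 0) (K (ones B)) ∷   -- d
  BIN SHR' (V aC) (R 3)       ∷   -- C >> p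
  BIN AND' (R 0) (K (ones B)) ∷   -- c
  BIN SUB' (R 2) (R 4)        ∷   -- d ∸ h, with borrow
  BIN SAR' (R 0) (K v)        ∷   -- right: all ones iff d < h
  NOT (R 0)                   ∷   -- left: all ones iff h ≤ d
  BIN AND' (R 1) (K B)        ∷   -- B if right, else 0
  BIN ADD' (R 9) (R 0)        ∷   -- new p
  BIN ADD' (R 9) (K B)        ∷   -- h + B
  BIN ADD' (R 6) (R 6)        ∷   -- 2c
  BIN SUB' (R 1) (R 0)        ∷   -- h + B ∸ 2c
  BIN AND' (R 0) (R 6)        ∷   -- h + B ∸ 2c if right
  BIN AND' (R 13) (R 6)       ∷   -- h if left
  BIN ADD' (R 5) (K 0)        ∷   -- copy the new p
  BIN ADD' (R 2) (R 1)        ∷   -- new h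
  []

read-shifted : ∀ w x y (L : List ℕ) a p → a < length L →
  shrW w (slot (x ∷ y ∷ L) a) p ≡ divPow (slot L a) p
read-shifted w x y L a p a< =
  cong (λ q → divPow q p) (trans (slot-∷ x (y ∷ L) a (≤-trans a< (n≤1+n _))) (slot-∷ y L a a<))

module DescendExecution (W v B aD aC : ℕ) (W≡ : W ≡ suc v) (L0 : List ℕ) (h p d c : ℕ)
  (aC< : aC < 2 + length L0)
  (d-ok : andW W (divPow (slot (h ∷ p ∷ L0) aD) p) (wrap W (ones B)) ≡ d)
  (c-ok : andW W (divPow (slot (h ∷ p ∷ L0) aC) p) (wrap W (ones B)) ≡ c)
  (d< : d < 2 ^ v) (h≤ : h ≤ 2 ^ v) (B< : B < 2 ^ W) (p+B< : p + B < 2 ^ W) (h+B< : h + B < 2 ^ W)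
  (2c< : c + c < 2 ^ W) where

  L : List ℕ
  L = h ∷ p ∷ L0

  p< : p < 2 ^ W
  p< = ≤-<-trans (m≤m+n p B) p+B<

  h< : h < 2 ^ W
  h< = ≤-<-trans (m≤m+n h B) h+B<

  D>>p : ℕ
  D>>p = divPow (slot L aD) p

  C>>p-ok : shrW W (slot (d ∷ D>>p ∷ L) aC) p ≡ divPow (slot L aC) p
  C>>p-ok = read-shifted W d D>>p L aC p aC<

  h+B-ok : addW W h (wrap W B) ≡ h + B
  h+B-ok = trans (cong (addW W h) (wrap-id W B B<)) (wrap-id W (h + B) h+B<)

  2c-ok : addW W c c ≡ c + c
  2c-ok = wrap-id W _ 2c<

  copy-ok : ∀ q → q < 2 ^ W → addW W q (wrap W 0) ≡ q
  copy-ok q q< = trans (cong (addW W q) (wrap-0 W)) (add-0 W q q<)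

  stay : h ≤ d → recent (exec W L (descendBlock B aD aC v)) 0 ≡ h × recent (exec W L (descendBlock B aD aC v)) 1 ≡ p
  stay h≤d =
    run-step₂ {v = D>>p} refl (run-step₂ d-ok (run-step₂ C>>p-ok (run-step₂ c-ok (run-step₂ {v = subW W d h} refl
    (run-step₂ right-ok (run-step₂ (not-zero W) (run-step₂ (and-zeroˡ W (wrap W B)) (run-step₂ (add-0 W p p<)
    (run-step₂ h+B-ok (run-step₂ 2c-ok (run-step₂ {v = subW W (h + B) (c + c)} refl
    (run-step₂ (and-zeroʳ W _) (run-step₂ (and-onesʳ W h h<) (run-step₂ (copy-ok p p<)
    (run-step₂ (wrap-id W h h<) (run-done₂ W _ (refl , refl)))))))))))))))))
    where
    right-ok : sarW W (subW W d h) (wrap W v) ≡ 0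
    right-ok = sign-mask-clear W v W≡ d h h≤d d<

  move : d < h → c + c ≤ h + B →
    recent (exec W L (descendBlock B aD aC v)) 0 ≡ h + B ∸ (c + c) × recent (exec W L (descendBlock B aD aC v)) 1 ≡ p + B
  move d<h 2c≤ =
    run-step₂ {v = D>>p} refl (run-step₂ d-ok (run-step₂ C>>p-ok (run-step₂ c-ok (run-step₂ {v = subW W d h} refl
    (run-step₂ right-ok (run-step₂ (not-ones W) (run-step₂ B-ok (run-step₂ (wrap-id W (p + B) p+B<)
    (run-step₂ h+B-ok (run-step₂ 2c-ok (run-step₂ h′-ok
    (run-step₂ (and-onesʳ W _ h′<) (run-step₂ (and-zeroʳ W h) (run-step₂ (copy-ok (p + B) p+B<)
    (run-step₂ (add-0 W _ h′<) (run-done₂ W _ (refl , refl)))))))))))))))))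
    where
    right-ok : sarW W (subW W d h) (wrap W v) ≡ ones W
    right-ok = sign-mask-set W v W≡ d h d<h h≤
    B-ok : andW W (ones W) (wrap W B) ≡ B
    B-ok = trans (cong (andW W (ones W)) (wrap-id W B B<)) (and-onesˡ W B B<)
    h′-ok : subW W (h + B) (c + c) ≡ h + B ∸ (c + c)
    h′-ok = sub-id W (h + B) (c + c) 2c≤ h+B<
    h′< : h + B ∸ (c + c) < 2 ^ W
    h′< = ≤-<-trans (m∸n≤m (h + B) (c + c)) h+B<

-- The final step at a single symbol: with d = md of symbol p (i.e. z p), the
-- output is p + 1 if h ≤ d and v + 1 = w otherwise.
leafBlock : (aD v : ℕ) → List Ins
leafBlock aD v =
  BIN SHR' (V aD) (R 1) ∷   -- D₀ >> p
  BIN AND' (R 0) (K 1)  ∷   -- d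
  BIN SUB' (R 0) (R 2)  ∷   -- d ∸ h, with borrow
  BIN SAR' (R 0) (K v)  ∷   -- all ones iff d < h
  BIN SUB' (K v) (R 5)  ∷   -- v ∸ p
  BIN AND' (R 0) (R 1)  ∷   -- v ∸ p if d < h, else 0
  BIN ADD' (R 7) (K 1)  ∷   -- p + 1
  BIN ADD' (R 0) (R 1)  ∷   -- p + 1, or v + 1
  []

module LeafExecution (W v aD : ℕ) (W≡ : W ≡ suc v) (L0 : List ℕ) (h p d : ℕ)
  (d-ok : andW W (divPow (slot (h ∷ p ∷ L0) aD) p) (wrap W 1) ≡ d)
  (d< : d < 2 ^ v) (h≤ : h ≤ 2 ^ v) (p≤v : p ≤ v) (W< : W < 2 ^ W) where

  L : List ℕ
  L = h ∷ p ∷ L0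

  v<W : v < W
  v<W = ≤-reflexive (sym W≡)

  v< : v < 2 ^ W
  v< = <-trans v<W W<

  p+1< : p + 1 < 2 ^ W
  p+1< = ≤-<-trans (≤-trans (≤-reflexive (+-comm p 1)) (≤-trans (s≤s p≤v) (≤-reflexive (sym W≡)))) W<

  v∸p-ok : subW W (wrap W v) p ≡ v ∸ p
  v∸p-ok = trans (cong (λ q → subW W q p) (wrap-id W v v<)) (sub-id W v p p≤v v<)

  p+1-ok : addW W p (wrap W 1) ≡ p + 1
  p+1-ok = trans (cong (addW W p) (wrap-id W 1 (≤-<-trans (≤-trans (s≤s z≤n) v<W) W<))) (wrap-id W (p + 1) p+1<)

  found : h ≤ d → recent (exec W L (leafBlock aD v)) 0 ≡ p + 1
  found h≤d =
    run-step {v = divPow (slot L aD) p} f refl (run-step f d-ok (run-step {v = subW W d h} f refl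
    (run-step f (sign-mask-clear W v W≡ d h h≤d d<) (run-step f v∸p-ok (run-step f (and-zeroʳ W (v ∸ p))
    (run-step f p+1-ok (run-step f (add-0 W (p + 1) p+1<) (cong f (exec-[] W _)))))))))
    where
    f : List ℕ → ℕ
    f E = recent E 0

  not-found : d < h → recent (exec W L (leafBlock aD v)) 0 ≡ W
  not-found d<h =
    run-step {v = divPow (slot L aD) p} f refl (run-step f d-ok (run-step {v = subW W d h} f refl
    (run-step f (sign-mask-set W v W≡ d h d<h h≤) (run-step f v∸p-ok (run-step f (and-onesʳ W (v ∸ p) v∸p<)
    (run-step f p+1-ok (run-step f overflow (cong f (exec-[] W _)))))))))
    where
    f : List ℕ → ℕ
    f E = recent E 0
    v∸p< : v ∸ p < 2 ^ W
    v∸p< = ≤-<-trans (m∸n≤m v p) v<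
    overflow : addW W (p + 1) (v ∸ p) ≡ W
    overflow = trans (cong (wrap W) (trans (cong (_+ (v ∸ p)) (+-comm p 1)) (trans (cong suc (m+[n∸m]≡n p≤v)) (sym W≡))))
                     (wrap-id W W W<)

pack-field : ∀ W B n v q → (∀ i → v i < 2 ^ B) → q < n → B ≤ W →
  andW W (divPow (pack B n v) (q * B)) (wrap W (ones B)) ≡ v q
pack-field W B n v q v< q<n B≤W with m≤n⇒∃[o]m+o≡n q<n
... | o , refl = begin
    andW W (divPow (pack B (suc q + o) v) (q * B)) (wrap W (ones B))
      ≡⟨ cong (λ t → andW W (divPow (pack B t v) (q * B)) (wrap W (ones B))) (sym (+-suc q o)) ⟩
    andW W (divPow (pack B (q + suc o) v) (q * B)) (wrap W (ones B))
      ≡⟨ cong₂ (andW W) (pack-drop B q (suc o) v (λ i _ → v< i))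
                        (wrap-id W (ones B) (<-≤-trans (ones<2^n B) (^-monoʳ-≤ 2 B≤W))) ⟩
    andW W (v (q + 0) + 2 ^ B * rest) (ones B)
      ≡⟨ cong (λ t → andW t (v (q + 0) + 2 ^ B * rest) (ones B)) (sym (m+[n∸m]≡n B≤W)) ⟩
    andW (B + (W ∸ B)) (v (q + 0) + 2 ^ B * rest) (ones B)
      ≡⟨ cong (andW (B + (W ∸ B)) _) (x≡x+2^g*0 (ones B) B) ⟩
    andW (B + (W ∸ B)) (v (q + 0) + 2 ^ B * rest) (ones B + 2 ^ B * 0)
      ≡⟨ field-low B (W ∸ B) _ _ (v< (q + 0)) ⟩
    v (q + 0)
      ≡⟨ cong v (+-identityʳ q) ⟩
    v q ∎
  where
  open ≡-Reasoning
  rest : ℕ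
  rest = pack B o (λ i → v (q + suc i))

-- The arithmetic behind a descent step.  The state (h, p) satisfies
-- h + 2·cl(0, p) = 1 + p, i.e. h is the depth of the open parenthesis at
-- position 0 after the symbols s₀ … s_p.
module Descent (z : ℕ → ℕ) (z-01 : Bits01 z) where

  -- If the depth h is at most md of the next block, the match lies before its end.
  go-left : ∀ p B h → h + 2 * cl z 0 p ≡ 1 + p → h ≤ md z p B → 1 ≤ md z 0 (p + B)
  go-left p B h depth h≤ = +-cancelʳ-≤ p 1 _ (begin
      1 + p                                        ≡⟨ sym depth ⟩
      h + 2 * cl z 0 p                             ≡⟨ +-comm h _ ⟩
      2 * cl z 0 p + h                             ≤⟨ +-monoʳ-≤ (2 * cl z 0 p) h≤ ⟩
      2 * cl z 0 p + md z p B                      ≤⟨ m≤n⊔m (md z 0 p + p) _ ⟩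
      (md z 0 p + p) ⊔ (2 * cl z 0 p + md z p B)   ≡⟨ sym (md-combine z z-01 0 p B) ⟩
      md z 0 (p + B) + p                           ∎)
    where open ≤-Reasoning

  -- Otherwise the prefix up to the end of the block still contains no match.
  go-right : ∀ p B h → md z 0 p ≡ 0 → h + 2 * cl z 0 p ≡ 1 + p → md z p B < h → md z 0 (p + B) ≡ 0
  go-right p B h md0 depth md<h = +-cancelʳ-≡ p _ 0 (begin
      md z 0 (p + B) + p                            ≡⟨ md-combine z z-01 0 p B ⟩
      (md z 0 p + p) ⊔ (2 * cl z 0 p + md z p B)    ≡⟨ cong (λ q → (q + p) ⊔ (2 * cl z 0 p + md z p B)) md0 ⟩
      p ⊔ (2 * cl z 0 p + md z p B)                 ≡⟨ m≥n⇒m⊔n≡m below ⟩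
      p                                             ∎)
    where
    open ≡-Reasoning
    below : 2 * cl z 0 p + md z p B ≤ p
    below = ≤-pred (≤-trans (≤-reflexive (sym (+-suc (2 * cl z 0 p) (md z p B))))
                   (≤-trans (+-monoʳ-≤ (2 * cl z 0 p) md<h) (≤-reflexive (trans (+-comm _ h) depth))))

  2cl≤h+B : ∀ p B h → md z p B < h → cl z p B + cl z p B ≤ h + B
  2cl≤h+B p B h md<h = ≤-trans (≤-reflexive (cong (cl z p B +_) (sym (+-identityʳ _))))
    (≤-trans (2cl≤L+md z z-01 p B) (≤-trans (+-monoʳ-≤ B (<⇒≤ md<h)) (≤-reflexive (+-comm B h))))

  go-right-depth : ∀ p B h → h + 2 * cl z 0 p ≡ 1 + p → md z p B < h →
    (h + B ∸ (cl z p B + cl z p B)) + 2 * cl z 0 (p + B) ≡ 1 + (p + B)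
  go-right-depth p B h depth md<h = begin
      (h + B ∸ 2c) + 2 * cl z 0 (p + B)   ≡⟨ cong (λ q → (h + B ∸ 2c) + 2 * q) (cl-+ z 0 p B) ⟩
      (h + B ∸ 2c) + 2 * (C₀ + c)         ≡⟨ regroup (h + B ∸ 2c) C₀ c ⟩
      (h + B ∸ 2c) + 2c + 2 * C₀          ≡⟨ cong (_+ 2 * C₀) (m∸n+n≡m (2cl≤h+B p B h md<h)) ⟩
      h + B + 2 * C₀                      ≡⟨ swap h B (2 * C₀) ⟩
      h + 2 * C₀ + B                      ≡⟨ cong (_+ B) depth ⟩
      1 + p + B                           ∎
    where
    open ≡-Reasoning
    c : ℕ
    c = cl z p B
    2c : ℕ
    2c = c + c
    C₀ : ℕ
    C₀ = cl z 0 p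
    regroup : ∀ a b c → a + 2 * (b + c) ≡ a + (c + c) + 2 * b
    regroup = solve-∀
    swap : ∀ a b c → a + b + c ≡ a + c + b
    swap = solve-∀

no-match-before : ∀ x → bit x 0 ≡ 1 → ∀ m → md (closedAt x) 0 m ≡ 0 →
  ∀ j → j ≤ m → excess x (suc j) ≢ ℤ.0ℤ
no-match-before x b0 m md0 j j≤ eq = 1+n≰n (≤-trans (≤-reflexive (sym 2cl≡1+j)) 2cl≤j)
  where
  2cl≡1+j : 2 * cl (closedAt x) 0 j ≡ suc j
  2cl≡1+j = +a-+b≡0⇒a≡b _ _ (trans (sym (excess≡2cl-[1+j] x b0 j)) eq)
  2cl≤j : 2 * cl (closedAt x) 0 j ≤ j
  2cl≤j = ≤-trans (2cl-prefix (closedAt x) (closedAt-01 x) 0 j m j≤) (≤-reflexive (trans (cong (j +_) md0) (+-identityʳ j)))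

initBlock : List Ins
initBlock = BIN ADD' (K 0) (K 0) ∷ BIN ADD' (K 1) (K 0) ∷ []   -- p := 0, h := 1

topDown : ℕ → ℕ → List Ins
topDown k zero    = []
topDown k (suc ℓ) = descendBlock (2 ^ ℓ) (addrD ℓ) (addrC ℓ) (2 ^ k ∸ 1) ++ topDown k ℓ

program : ℕ → List Ins
program k = preamble ++ (bottomUp k (k ∸ 1) ++ (initBlock ++ (topDown k k ++ leafBlock (addrD 0) (2 ^ k ∸ 1))))

record State (z : ℕ → ℕ) (w S p h : ℕ) : Set where
  field
    index   : ℕ
    aligned : p ≡ index * S
    fits    : p + S ≤ w
    clear   : md z 0 p ≡ 0
    depth   : h + 2 * cl z 0 p ≡ 1 + p
    inside  : 1 ≤ md z 0 w → 1 ≤ md z 0 (p + S)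

module TopDown (k′ x : ℕ) (x< : x < 2 ^ (2 ^ suc k′)) where

  k : ℕ
  k = suc k′

  open Words k x x<
  open BottomUp k x x<
  open Descent z z-01

  v : ℕ
  v = w ∸ 1

  w≡1+v : w ≡ suc v
  w≡1+v = trans (sym (m∸n+n≡m {w} {1} w≥1)) (+-comm v 1)

  v≥1 : 1 ≤ v
  v≥1 = ≤-pred (subst (2 ≤_) w≡1+v (*-monoʳ-≤ 2 (m^n>0 2 k′)))

  w<2^w : w < 2 ^ w
  w<2^w = n<2^n w

  ≤v⇒<2^w : ∀ {a} → a ≤ v → a < 2 ^ w
  ≤v⇒<2^w a≤ = ≤-<-trans (≤-trans a≤ (≤-trans (n≤1+n v) (≤-reflexive (sym w≡1+v)))) w<2^w

  Available : List ℕ → Set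
  Available L = ∀ j → j < k → addrD j < length L × slot L (addrD j) ≡ D j × slot L (addrC j) ≡ C j

  available-exec : ∀ L is → Available L → Available (exec w L is)
  available-exec L is av j j< =
    ≤-trans addrD< (≤-trans (m≤n+m _ (length is)) (≤-reflexive (sym (length-exec w L is)))) ,
    trans (slot-exec w L is _ addrD<) D-ok ,
    trans (slot-exec w L is _ (<-trans (addrC<addrD j) addrD<)) C-ok
    where
    addrD< : addrD j < length L
    addrD< = proj₁ (av j j<)
    D-ok : slot L (addrD j) ≡ D j
    D-ok = proj₁ (proj₂ (av j j<))
    C-ok : slot L (addrC j) ≡ C j
    C-ok = proj₂ (proj₂ (av j j<))

  record Reached (E : List ℕ) (S : ℕ) : Set where
    field
      h p       : ℕ
      rest      : List ℕ
      shape     : E ≡ h ∷ p ∷ rest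
      available : Available E
      state     : State z w S p h

  reached-after : ∀ E is S {h p} → 2 ≤ length E → Available E →
    recent (exec w E is) 0 ≡ h → recent (exec w E is) 1 ≡ p → State z w S p h → Reached (exec w E is) S
  reached-after E is S {h} {p} 2≤ av top-h top-p st = record
    { h = h ; p = p ; rest = drop 2 E′ ; available = available-exec E is av ; state = st
    ; shape = trans (top-two E′ 2≤′) (cong₂ (λ a b → a ∷ b ∷ drop 2 E′) top-h top-p) }
    where
    E′ : List ℕ
    E′ = exec w E is
    2≤′ : 2 ≤ length E′
    2≤′ = ≤-trans 2≤ (≤-trans (m≤n+m _ (length is)) (≤-reflexive (sym (length-exec w E is))))

  module DescentStep (ℓ : ℕ) (ℓ<k : ℓ < k) (E : List ℕ) (r : Reached E (2 ^ suc ℓ)) where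

    open Reached r
    open State state

    B n d c : ℕ
    B = 2 ^ ℓ
    n = 2 ^ (k ∸ ℓ)
    d = md z p B
    c = cl z p B

    B≥1 : 1 ≤ B
    B≥1 = m^n>0 2 ℓ

    p≡[2q]B : p ≡ (index * 2) * B
    p≡[2q]B = trans aligned (sym (*-assoc index 2 B))

    p+B+B≤w : p + (B + B) ≤ w
    p+B+B≤w = subst (λ t → p + t ≤ w) (cong (B +_) (+-identityʳ B)) fits

    B≤w : B ≤ w
    B≤w = ≤-trans (m≤n+m B (p + B)) (≤-trans (≤-reflexive (+-assoc p B B)) p+B+B≤w)

    2q<n : index * 2 < n
    2q<n = *-cancelʳ-≤ (suc (index * 2)) n B {{m^n≢0 2 ℓ}} (begin
        B + index * 2 * B   ≤⟨ +-monoʳ-≤ B (≤-trans (≤-reflexive (sym p≡[2q]B)) (m≤m+n p B)) ⟩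
        B + (p + B)         ≡⟨ trans (+-comm B (p + B)) (+-assoc p B B) ⟩
        p + (B + B)         ≤⟨ p+B+B≤w ⟩
        w                   ≡⟨ sym (fields-cover ℓ (<⇒≤ ℓ<k)) ⟩
        n * B               ∎)
      where open ≤-Reasoning

    L : List ℕ
    L = h ∷ p ∷ rest

    av : Available L
    av = subst Available shape available

    read-field : ∀ (stat : ℕ → ℕ) (a : ℕ) → slot L a ≡ pack B n stat → (∀ i → stat i < 2 ^ B) →
      andW w (divPow (slot L a) p) (wrap w (ones B)) ≡ stat (index * 2)
    read-field stat a stored stat< = begin
        andW w (divPow (slot L a) p) (wrap w (ones B))
          ≡⟨ cong₂ (λ t u → andW w (divPow t u) (wrap w (ones B))) stored p≡[2q]B ⟩
        andW w (divPow (pack B n stat) ((index * 2) * B)) (wrap w (ones B))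
          ≡⟨ pack-field w B n stat (index * 2) stat< 2q<n B≤w ⟩
        stat (index * 2) ∎
      where open ≡-Reasoning

    d-ok : andW w (divPow (slot L (addrD ℓ)) p) (wrap w (ones B)) ≡ d
    d-ok = trans (read-field _ (addrD ℓ) (proj₁ (proj₂ (av ℓ ℓ<k))) (λ i → ≤-<-trans (md-≤ z _ _) (n<2^n B)))
                 (cong (λ t → md z t B) (sym p≡[2q]B))

    c-ok : andW w (divPow (slot L (addrC ℓ)) p) (wrap w (ones B)) ≡ c
    c-ok = trans (read-field _ (addrC ℓ) (proj₂ (proj₂ (av ℓ ℓ<k))) (λ i → ≤-<-trans (cl-≤ z z-01 _ _) (n<2^n B)))
                 (cong (λ t → cl z t B) (sym p≡[2q]B))

    h≤1+p : h ≤ 1 + p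
    h≤1+p = ≤-trans (m≤m+n h _) (≤-reflexive depth)

    p+B≤v : p + B ≤ v
    p+B≤v = ≤-pred (subst (suc (p + B) ≤_) w≡1+v
      (≤-trans (≤-reflexive (+-comm 1 (p + B)))
               (≤-trans (+-monoʳ-≤ (p + B) B≥1) (≤-trans (≤-reflexive (+-assoc p B B)) p+B+B≤w))))

    h≤v : h ≤ v
    h≤v = ≤-trans h≤1+p (≤-trans (≤-trans (≤-reflexive (+-comm 1 p)) (+-monoʳ-≤ p B≥1)) p+B≤v)

    open DescendExecution w v B (addrD ℓ) (addrC ℓ) w≡1+v rest h p d c
      (<-trans (addrC<addrD ℓ) (proj₁ (av ℓ ℓ<k))) d-ok c-ok
      (≤-<-trans (≤-trans (md-≤ z p B) (≤-trans (m≤n+m B p) p+B≤v)) (n<2^n v))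
      (≤-trans h≤v (<⇒≤ (n<2^n v)))
      (≤v⇒<2^w (≤-trans (m≤n+m B p) p+B≤v))
      (≤v⇒<2^w p+B≤v)
      (≤-<-trans (≤-trans (+-monoˡ-≤ B h≤1+p) (≤-trans (s≤s p+B≤v) (≤-reflexive (sym w≡1+v)))) w<2^w)
      (≤-<-trans (≤-trans (+-mono-≤ (cl-≤ z z-01 p B) (cl-≤ z z-01 p B)) (≤-trans (m≤n+m (B + B) p) p+B+B≤w)) w<2^w)
      using (stay; move)

    blk : List Ins
    blk = descendBlock B (addrD ℓ) (addrC ℓ) v

    2≤length : 2 ≤ length L
    2≤length = s≤s (s≤s z≤n)

    step : Reached (exec w E blk) B
    step with h ≤? d
    ... | yes h≤d = subst (λ E′ → Reached (exec w E′ blk) B) (sym shape)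
      (reached-after L blk B 2≤length av (proj₁ (stay h≤d)) (proj₂ (stay h≤d)) record
        { index = index * 2 ; aligned = p≡[2q]B ; fits = ≤-trans (+-monoʳ-≤ p (m≤m+n B B)) p+B+B≤w
        ; clear = clear ; depth = depth ; inside = λ _ → go-left p B h depth h≤d })
    ... | no h≰d = subst (λ E′ → Reached (exec w E′ blk) B) (sym shape)
      (reached-after L blk B 2≤length av (proj₁ (move d<h 2c≤)) (proj₂ (move d<h 2c≤)) record
        { index = suc (index * 2) ; aligned = trans (+-comm p B) (cong (B +_) p≡[2q]B)
        ; fits = ≤-trans (≤-reflexive (+-assoc p B B)) p+B+B≤w
        ; clear = go-right p B h clear depth d<h
        ; depth = go-right-depth p B h depth d<h
        ; inside = λ m≥1 → subst (λ t → 1 ≤ md z 0 t) 2B-block (inside m≥1) })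
      where
      d<h : d < h
      d<h = ≰⇒> h≰d
      2c≤ : c + c ≤ h + B
      2c≤ = 2cl≤h+B p B h d<h
      2B-block : p + 2 ^ suc ℓ ≡ p + B + B
      2B-block = trans (cong (λ t → p + (B + t)) (+-identityʳ B)) (sym (+-assoc p B B))

  descend : ∀ ℓ → ℓ ≤ k → ∀ E → Reached E (2 ^ ℓ) → Reached (exec w E (topDown k ℓ)) 1
  descend zero    _  E r = subst (λ E′ → Reached E′ 1) (sym (exec-[] w E)) r
  descend (suc ℓ) le E r =
    subst (λ E′ → Reached E′ 1) (sym (exec-++ w E (DescentStep.blk ℓ le E r) (topDown k ℓ)))
          (descend ℓ (≤-trans (n≤1+n ℓ) le) _ (DescentStep.step ℓ le E r))

  module Finish (E : List ℕ) (r : Reached E 1) (b0 : bit x 0 ≡ 1) where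

    open Reached r
    open State state

    L : List ℕ
    L = h ∷ p ∷ rest

    d : ℕ
    d = md z p 1

    p≤v : p ≤ v
    p≤v = ≤-pred (subst (suc p ≤_) w≡1+v (≤-trans (≤-reflexive (+-comm 1 p)) fits))

    d≤1 : d ≤ 1
    d≤1 = md-≤ z p 1

    d-ok : andW w (divPow (slot L (addrD 0)) p) (wrap w 1) ≡ d
    d-ok = begin
        andW w (divPow (slot L (addrD 0)) p) (wrap w 1)
          ≡⟨ cong₂ (λ t u → andW w (divPow t u) (wrap w 1))
                   (proj₁ (proj₂ (subst Available shape available 0 (s≤s z≤n)))) (sym (*-identityʳ p)) ⟩
        andW w (divPow (D 0) (p * 1)) (wrap w 1)
          ≡⟨ pack-field w 1 w (λ j → md z (j * 1) 1) p (λ i → s≤s (md-≤ z (i * 1) 1))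
                        (≤-trans (≤-reflexive (+-comm 1 p)) fits) w≥1 ⟩
        md z (p * 1) 1
          ≡⟨ cong (λ t → md z t 1) (*-identityʳ p) ⟩
        d ∎
      where open ≡-Reasoning

    h≤1+p : h ≤ 1 + p
    h≤1+p = ≤-trans (m≤m+n h _) (≤-reflexive depth)

    open LeafExecution w v (addrD 0) w≡1+v rest h p d d-ok
      (≤-<-trans (≤-trans d≤1 v≥1) (n<2^n v)) (≤-trans h≤1+p (≤-trans (s≤s p≤v) (n<2^n v))) p≤v w<2^w
      using (found; not-found)

    earlier : ∀ m → md z 0 m ≡ 0 → ∀ j → j ≤ m → excess x (suc j) ≢ ℤ.0ℤ
    earlier = no-match-before x b0

    match : h ≤ d → excess x (suc (p + 1)) ≡ ℤ.0ℤ
    match h≤d = trans (excess≡2cl-[1+j] x b0 (p + 1))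
                      (trans (cong (λ t → ℤ.+ t ℤ.- ℤ.+ suc (p + 1)) 2cl≡) (+a-+a≡0 (suc (p + 1))))
      where
      open ≡-Reasoning
      2cl≤p : 2 * cl z 0 p ≤ p
      2cl≤p = ≤-trans (2cl≤L+md z z-01 0 p) (≤-reflexive (trans (cong (p +_) clear) (+-identityʳ p)))
      h≥1 : 1 ≤ h
      h≥1 = +-cancelʳ-≤ (2 * cl z 0 p) 1 h (≤-trans (+-monoʳ-≤ 1 2cl≤p) (≤-reflexive (sym depth)))
      h≡1 : h ≡ 1
      h≡1 = ≤-antisym (≤-trans h≤d d≤1) h≥1
      z≡1 : z p ≡ 1
      z≡1 = trans (sym (md-one z z-01 p)) (≤-antisym d≤1 (≤-trans h≥1 h≤d))
      2cl≡p : 2 * cl z 0 p ≡ p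
      2cl≡p = +-cancelˡ-≡ 1 _ _ (trans (cong (_+ 2 * cl z 0 p) (sym h≡1)) depth)
      2cl≡ : 2 * cl z 0 (p + 1) ≡ suc (p + 1)
      2cl≡ = begin
          2 * cl z 0 (p + 1)    ≡⟨ cong (2 *_) (trans (cong (cl z 0) (+-comm p 1)) (cl-snoc z 0 p)) ⟩
          2 * (cl z 0 p + z p)  ≡⟨ cong (λ t → 2 * (cl z 0 p + t)) z≡1 ⟩
          2 * (cl z 0 p + 1)    ≡⟨ *-distribˡ-+ 2 (cl z 0 p) 1 ⟩
          2 * cl z 0 p + 2      ≡⟨ cong (_+ 2) 2cl≡p ⟩
          p + 2                 ≡⟨ +-suc p 1 ⟩
          suc (p + 1)           ∎

    output-correct : CorrectOutput w w x (recent (exec w L (leafBlock (addrD 0) v)) 0)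
    output-correct with h ≤? d
    ... | yes h≤d with p + 1 <? w
    ...   | yes p+1<w = inj₁ (p + 1 , (subst (0 <_) (+-comm 1 p) (s≤s z≤n) , p+1<w , match h≤d , before) , found h≤d)
      where
      before : ∀ j → 0 < j → j < p + 1 → excess x (suc j) ≢ ℤ.0ℤ
      before j _ j< = earlier p clear j (≤-pred (subst (suc j ≤_) (+-comm p 1) j<))
    ...   | no p+1≮w = inj₂ ((λ j _ j< → earlier p clear j (≤-pred (subst (suc j ≤_) (trans (sym p+1≡w) (+-comm p 1)) j<))) ,
                             trans (found h≤d) p+1≡w)
      where
      p+1≡w : p + 1 ≡ w
      p+1≡w = ≤-antisym fits (≮⇒≥ p+1≮w)
    output-correct | no h≰d = inj₂ ((λ j _ j< → earlier w md-w≡0 j (<⇒≤ j<)) , not-found d<h)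
      where
      d<h : d < h
      d<h = ≰⇒> h≰d
      md-w≡0 : md z 0 w ≡ 0
      md-w≡0 with md z 0 w | inside
      ... | zero  | _   = refl
      ... | suc _ | ins = ⊥-elim (1+n≰n (≤-trans (ins (s≤s z≤n)) (≤-reflexive (go-right p 1 h clear depth d<h))))

  P : SLP 1
  P = compile 1 (program k) (R 0)

  bottom : List ℕ
  bottom = values k′

  bottom-available : Available bottom
  bottom-available j j< =
    subst (addrD j <_) (sym length-ok) (≤-trans (addrD<stored j) (stored-mono j k′ (≤-pred j<))) ,
    in-slots j (≤-pred j<)
    where open Computed (computed k′ (n<1+n k′))

  init-ok : exec w bottom initBlock ≡ 1 ∷ 0 ∷ bottom
  init-ok = trans (exec-∷ w _ _ _) (trans (exec-∷ w _ _ _) (trans (exec-[] w _) (cong₂ (λ a b → a ∷ b ∷ bottom) one zero′)))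
    where
    one : addW w (wrap w 1) (wrap w 0) ≡ 1
    one = trans (cong₂ (addW w) (wrap-id w 1 1<2^w) (wrap-0 w)) (wrap-id w 1 1<2^w)
    zero′ : addW w (wrap w 0) (wrap w 0) ≡ 0
    zero′ = trans (cong₂ (addW w) (wrap-0 w) (wrap-0 w)) (wrap-0 w)

  start : Reached (exec w bottom initBlock) w
  start = record
    { h = 1 ; p = 0 ; rest = bottom ; shape = init-ok
    ; available = available-exec bottom initBlock bottom-available
    ; state = record { index = 0 ; aligned = refl ; fits = ≤-refl ; clear = refl ; depth = refl ; inside = λ m≥1 → m≥1 } }

  run≡ : run w P x ≡ recent (exec w (exec w (exec w bottom initBlock) (topDown k k)) (leafBlock (addrD 0) v)) 0
  run≡ = trans (compile-correct w (x Vec.∷ Vec.[]) (program k) (R 0)) (cong (λ E → recent E 0) phases)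
    where
    open ≡-Reasoning
    phases : exec w (x ∷ []) (program k) ≡ exec w (exec w (exec w bottom initBlock) (topDown k k)) (leafBlock (addrD 0) v)
    phases = begin
        exec w (x ∷ []) (preamble ++ (bottomUp k k′ ++ rest₁))
          ≡⟨ cong (exec w (x ∷ [])) (sym (List.++-assoc preamble (bottomUp k k′) _)) ⟩
        exec w (x ∷ []) ((preamble ++ bottomUp k k′) ++ rest₁)
          ≡⟨ exec-++ w (x ∷ []) (preamble ++ bottomUp k k′) _ ⟩
        exec w bottom (initBlock ++ (topDown k k ++ leafBlock (addrD 0) v))
          ≡⟨ exec-++ w bottom initBlock _ ⟩
        exec w (exec w bottom initBlock) (topDown k k ++ leafBlock (addrD 0) v)
          ≡⟨ exec-++ w (exec w bottom initBlock) (topDown k k) _ ⟩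
        exec w (exec w (exec w bottom initBlock) (topDown k k)) (leafBlock (addrD 0) v) ∎
      where
      rest₁ : List Ins
      rest₁ = initBlock ++ (topDown k k ++ leafBlock (addrD 0) v)

  correct : bit x 0 ≡ 1 → CorrectOutput w w x (run w P x)
  correct b0 = subst (CorrectOutput w w x) (sym run≡)
    (subst (λ E → CorrectOutput w w x (recent (exec w E (leafBlock (addrD 0) v)) 0)) (sym (Reached.shape final))
           (Finish.output-correct _ final b0))
    where
    final : Reached (exec w (exec w bottom initBlock) (topDown k k)) 1
    final = descend k ≤-refl _ start

length-bottomUp : ∀ k ℓ → length (bottomUp k ℓ) ≤ 21 * ℓ
length-bottomUp k zero          = z≤n
length-bottomUp k (suc zero)    = from-yes (7 ≤? 21)
length-bottomUp k (suc (suc j)) = begin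
    length (bottomUp k (suc j) ++ blk)  ≡⟨ List.length-++ (bottomUp k (suc j)) {blk} ⟩
    length (bottomUp k (suc j)) + 21    ≤⟨ +-monoˡ-≤ 21 (length-bottomUp k (suc j)) ⟩
    21 * suc j + 21                     ≡⟨ +-comm (21 * suc j) 21 ⟩
    21 + 21 * suc j                     ≡⟨ sym (*-suc 21 (suc j)) ⟩
    21 * suc (suc j)                    ∎
  where
  open ≤-Reasoning
  blk : List Ins
  blk = levelBlock (2 ^ suc j) (guardBit (suc j)) (2 ^ (k ∸ suc (suc j)))

length-topDown : ∀ k ℓ → length (topDown k ℓ) ≡ 16 * ℓ
length-topDown k zero    = refl
length-topDown k (suc ℓ) =
  trans (List.length-++ (descendBlock (2 ^ ℓ) (addrD ℓ) (addrC ℓ) (2 ^ k ∸ 1)) {topDown k ℓ})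
        (trans (cong (16 +_) (length-topDown k ℓ)) (sym (*-suc 16 ℓ)))

length-program : ∀ k → length (program k) ≡ 3 + (length (bottomUp k (k ∸ 1)) + (2 + (length (topDown k k) + 8)))
length-program k =
  trans (List.length-++ preamble {bottomUp k (k ∸ 1) ++ tail₁})
        (cong (3 +_) (trans (List.length-++ (bottomUp k (k ∸ 1)) {tail₁})
          (cong (length (bottomUp k (k ∸ 1)) +_) (trans (List.length-++ initBlock {tail₂})
            (cong (2 +_) (List.length-++ (topDown k k) {leafBlock (addrD 0) (2 ^ k ∸ 1)}))))))
  where
  tail₂ : List Ins
  tail₂ = topDown k k ++ leafBlock (addrD 0) (2 ^ k ∸ 1)
  tail₁ : List Ins
  tail₁ = initBlock ++ tail₂

size-bound : ∀ k → length (program (suc k)) ≤ 40 * suc k + 40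
size-bound k = begin
    length (program (suc k))                 ≡⟨ length-program (suc k) ⟩
    3 + (a + (2 + (b + 8)))                  ≡⟨ regroup a b ⟩
    (a + b) + 13
      ≤⟨ +-mono-≤ (+-mono-≤ a≤ (≤-reflexive (length-topDown (suc k) (suc k)))) (from-yes (13 ≤? 40)) ⟩
    (21 * suc k + 16 * suc k) + 40           ≡⟨ cong (_+ 40) (sym (*-distribʳ-+ (suc k) 21 16)) ⟩
    37 * suc k + 40                          ≤⟨ +-monoˡ-≤ 40 (*-monoˡ-≤ (suc k) (from-yes (37 ≤? 40))) ⟩
    40 * suc k + 40                          ∎
  where
  open ≤-Reasoning
  a : ℕ
  a = length (bottomUp (suc k) k)
  b : ℕ
  b = length (topDown (suc k) (suc k))
  a≤ : a ≤ 21 * suc k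
  a≤ = ≤-trans (length-bottomUp (suc k) k) (*-monoʳ-≤ 21 (n≤1+n k))
  regroup : ∀ a b → 3 + (a + (2 + (b + 8))) ≡ (a + b) + 13
  regroup = solve-∀

-- The programs; for w = 1 the only admissible input is 1, the special value.
matcher : ℕ → SLP 1
matcher zero     = ret (reg zero)
matcher (suc k)  = compile 1 (program (suc k)) (R 0)

matcher-size : ∀ k → size (matcher k) ≤ 40 * k + 40
matcher-size zero    = z≤n
matcher-size (suc k) = subst (_≤ 40 * suc k + 40) (sym (size-compile 1 (program (suc k)) (R 0))) (size-bound k)

matcher-mulCount : ∀ k → mulCount (matcher k) ≤ 0
matcher-mulCount zero    = z≤n
matcher-mulCount (suc k) = ≤-reflexive (mulCount-compile 1 (program (suc k)) (R 0))

matcher-correct : ∀ k x → x < 2 ^ (2 ^ k) → bit x 0 ≡ 1 → CorrectOutput (2 ^ k) (2 ^ k) x (run (2 ^ k) (matcher k) x)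
matcher-correct zero    zero          _               ()
matcher-correct zero    (suc zero)    _               _  = inj₂ ((λ { j (s≤s _) (s≤s ()) }) , refl)
matcher-correct zero    (suc (suc x)) (s≤s (s≤s ())) _
matcher-correct (suc k) x x< b0 = TopDown.correct k x x< b0

mainTheorem2 : Σ ℕ λ C → Σ ℕ λ M → Σ (ℕ → SLP 1) λ P → Σ (ℕ → ℕ) λ special →
    (k : ℕ) →
      size (P k) ≤ C * k + C × mulCount (P k) ≤ M × 2 ^ k ≤ special k
      × ((x : ℕ) → x < 2 ^ (2 ^ k) → bit x 0 ≡ 1 →
           CorrectOutput (2 ^ k) (special k) x (run (2 ^ k) (P k) x))
mainTheorem2 = 40 , 0 , matcher , (λ k → 2 ^ k) ,
  λ k → matcher-size k , matcher-mulCount k , ≤-refl , matcher-correct k
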